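{- For every integer $n\geq 2$, $m_2(C_3,C_4,nK_2)=\infty$ and $m_3(C_3,C_4,nK_2)=n+2$.
   Context: $K_{j\times t}$ denotes the complete multipartite graph with $j$ partite sets, each of size $t$. For graphs $H_1,\ldots,H_k$, the multipartite Ramsey number $m_j(H_1,\ldots,H_k)$ is the smallest positive integer $t$ such that for every $k$-edge-coloring $(G^1,\ldots,G^k)$ of $K_{j\times t}$ (partition of its edges into spanning subgraphs), some $G^\ell$ contains a copy of $H_\ell$; it is $\infty$ if no such $t$ exists. $C_m$ is the cycle on $m$ vertices and $nK_2$ is a matching of $n$ edges. -}

module Defs where

open import Data.Nat using (ℕ; zero; suc; _≤_; _<_; NonZero)
open import Data.Nat.DivMod using (_%_)
open import Data.Fin using (Fin; toℕ)
open import Data.Product using (Σ; _×_; _,_; proj₁)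
open import Data.Sum using (_⊎_)
open import Relation.Nullary using (¬_)
open import Relation.Binary.PropositionalEquality using (_≡_; _≢_)
open import Function.Definitions using (Injective)

record Graph : Set₁ where
  field
    V : Set
    E : V → V → Set
open Graph public

Cycle : (m : ℕ) → .{{NonZero m}} → Graph
Cycle m = record
  { V = Fin m
  ; E = λ x y → (toℕ y ≡ suc (toℕ x) % m) ⊎ (toℕ x ≡ suc (toℕ y) % m) }

Matching : ℕ → Graph
Matching n = record
  { V = Fin n × Fin 2
  ; E = λ { (i , a) (k , b) → (i ≡ k) × (a ≢ b) } }

-- Vertices of the complete multipartite graph K_{j×t}: (part , index in part).
KV : ℕ → ℕ → Set
KV j t = Fin j × Fin t

KAdj : (j t : ℕ) → KV j t → KV j t → Set
KAdj j t u v = proj₁ u ≢ proj₁ v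

-- A k-edge-colouring of K_{j×t}: a symmetric assignment of a colour to every
-- pair of vertices (only values on edges matter).
record Colouring (k j t : ℕ) : Set where
  field
    col  : KV j t → KV j t → Fin k
    symm : ∀ u v → col u v ≡ col v u
open Colouring public

ColourClass : ∀ {k j t} → Colouring k j t → Fin k → KV j t → KV j t → Set
ColourClass {k} {j} {t} c ℓ u v = KAdj j t u v × (col c u v ≡ ℓ)

ContainsCopy : {W : Set} → (W → W → Set) → Graph → Set
ContainsCopy {W} G H =
  Σ (V H → W) λ f → Injective _≡_ _≡_ f × (∀ x y → E H x y → G (f x) (f y))

Arrows : (j t k : ℕ) → (Fin k → Graph) → Set
Arrows j t k Hs = (c : Colouring k j t) → Σ (Fin k) λ ℓ → ContainsCopy (ColourClass c ℓ) (Hs ℓ)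

MultipartiteRamseyIs : (j k : ℕ) → (Fin k → Graph) → ℕ → Set
MultipartiteRamseyIs j k Hs t =
  (1 ≤ t) × Arrows j t k Hs × (∀ s → 1 ≤ s → s < t → ¬ Arrows j s k Hs)

MultipartiteRamseyInfinite : (j k : ℕ) → (Fin k → Graph) → Set
MultipartiteRamseyInfinite j k Hs = ∀ t → 1 ≤ t → ¬ Arrows j t k Hs

C3C4nK2 : ℕ → Fin 3 → Graph
C3C4nK2 n Fin.zero = Cycle 3
C3C4nK2 n (Fin.suc Fin.zero) = Cycle 4
C3C4nK2 n (Fin.suc (Fin.suc Fin.zero)) = Matching n

-- The colouring of K_{2×t} that is red everywhere shows m₂ = ∞: its red class is bipartite and the
-- other classes are empty.
--
-- For the upper bound m₃ ≤ n + 2, every red/blue/green colouring of K_{3×3} has a red C₃, a blue C₄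
-- or a green edge; this is checked by a finite case split on edge colours. Given a colouring of
-- K_{3×(n+2)} without red C₃ and blue C₄, this yields a green edge uv; deleting u, v and one further
-- vertex leaves a copy of K_{3×(n+1)}, in which induction gives a green (n−1)K₂ disjoint from uv.
--
-- For the lower bound, colour K_{3×s} (s ≤ n + 1), with parts A, B, C, as follows: a₀B and a₁C blue,
-- every edge at a₂, …, a_{s−1} green, all else red. Red is bipartite with sides {a₀} ∪ B and
-- {a₁} ∪ C, blue is two stars centred in A, and a₂, …, a_{s−1} cover all green edges, so a green
-- matching has at most s − 2 < n edges.
module Submission where

open import Data.Empty using (⊥; ⊥-elim)
open import Data.Fin using (Fin; zero; suc; toℕ; fromℕ<; punchIn; _↑ˡ_)
open import Data.Fin.Properties
  using (_≟_; toℕ-injective; toℕ-fromℕ<; punchInᵢ≢i; punchIn-injective; ↑ˡ-injective; pigeonhole; <⇒≢)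
import Data.Fin as Fin
open import Data.List using (List; []; _∷_)
open import Data.List.Membership.Propositional using (_∈_)
open import Data.List.Relation.Unary.All as All using (All; []; _∷_)
open import Data.Nat using (ℕ; zero; suc; _+_; _∸_; _≤_; _<_; s≤s; z≤n; NonZero; >-nonZero)
open import Data.Nat.DivMod using (_%_; m%n<n)
open import Data.Nat.Properties using (+-comm; <⇒≤; m<n+o⇒m∸n<o)
open import Data.Product using (Σ; ∃₂; _×_; _,_; proj₁; proj₂)
open import Data.Product.Properties using (≡-dec; ,-injectiveˡ; ,-injectiveʳ)
open import Data.Sum using (_⊎_; inj₁; inj₂)
open import Data.Unit using (tt)
open import Data.Vec using (Vec; []; _∷_; lookup)
open import Data.Vec.Relation.Unary.All using ([]; _∷_)
open import Data.Vec.Relation.Unary.AllPairs using ([]; _∷_)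
open import Data.Vec.Relation.Unary.Unique.Propositional using (Unique)
open import Data.Vec.Relation.Unary.Unique.Propositional.Properties using (lookup-injective)
open import Function using (_∘_; case_of_)
open import Function.Definitions using (Injective)
open import Relation.Binary.Definitions using (Symmetric; Irreflexive; DecidableEquality)
open import Relation.Binary.PropositionalEquality using (_≡_; _≢_; refl; sym; trans; cong; subst)
open import Relation.Nullary using (¬_; Dec; yes; no; ¬?)
open import Relation.Nullary.Decidable using (_×-dec_; _⊎-dec_; toWitness)
open import Relation.Unary using (Decidable)

open import Defs

pattern red   = zero
pattern blue  = suc zero
pattern green = suc (suc zero)

next : ∀ {m} .{{_ : NonZero m}} → Fin m → Fin m
next {m} i = fromℕ< (m%n<n (suc (toℕ i)) m)

cycle3-complete : ∀ {i j : Fin 3} → i ≢ j → E (Cycle 3) i j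
cycle3-complete {zero}           {zero}           i≢j = ⊥-elim (i≢j refl)
cycle3-complete {zero}           {suc zero}       _   = inj₁ refl
cycle3-complete {zero}           {suc (suc zero)} _   = inj₂ refl
cycle3-complete {suc zero}       {zero}           _   = inj₂ refl
cycle3-complete {suc zero}       {suc zero}       i≢j = ⊥-elim (i≢j refl)
cycle3-complete {suc zero}       {suc (suc zero)} _   = inj₁ refl
cycle3-complete {suc (suc zero)} {zero}           _   = inj₁ refl
cycle3-complete {suc (suc zero)} {suc zero}       _   = inj₂ refl
cycle3-complete {suc (suc zero)} {suc (suc zero)} i≢j = ⊥-elim (i≢j refl)

module _ {W : Set} {G : W → W → Set} where

  cycle-copy : ∀ {m} .{{_ : NonZero m}} → Symmetric G → (vs : Vec W m) → Unique vs →
               (∀ i → G (lookup vs i) (lookup vs (next i))) → ContainsCopy G (Cycle m)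
  cycle-copy G-sym vs distinct step = lookup vs , lookup-injective distinct _ _ , edge
    where
    next-≡ : ∀ {i j} → toℕ j ≡ suc (toℕ i) % _ → next i ≡ j
    next-≡ e = toℕ-injective (trans (toℕ-fromℕ< _) (sym e))

    edge : ∀ i j → E (Cycle _) i j → G (lookup vs i) (lookup vs j)
    edge i j (inj₁ e) = subst (G (lookup vs i) ∘ lookup vs) (next-≡ e) (step i)
    edge i j (inj₂ e) = G-sym (subst (G (lookup vs j) ∘ lookup vs) (next-≡ e) (step j))

  triangle-copy : Symmetric G → Irreflexive _≡_ G → ∀ {x y z} →
                  G x y → G y z → G z x → ContainsCopy G (Cycle 3)
  triangle-copy G-sym irr {x} {y} {z} xy yz zx = cycle-copy G-sym (x ∷ y ∷ z ∷ []) distinct step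
    where
    distinct : Unique (x ∷ y ∷ z ∷ [])
    distinct = ((λ e → irr e xy) ∷ (λ e → irr (sym e) zx) ∷ []) ∷ ((λ e → irr e yz) ∷ []) ∷ [] ∷ []

    step : ∀ i → G (lookup (x ∷ y ∷ z ∷ []) i) (lookup (x ∷ y ∷ z ∷ []) (next i))
    step zero             = xy
    step (suc zero)       = yz
    step (suc (suc zero)) = zx

  square-copy : Symmetric G → Irreflexive _≡_ G → ∀ {x y z w} →
                G x y → G y z → G z w → G w x → x ≢ z → y ≢ w → ContainsCopy G (Cycle 4)
  square-copy G-sym irr {x} {y} {z} {w} xy yz zw wx x≢z y≢w =
    cycle-copy G-sym (x ∷ y ∷ z ∷ w ∷ []) distinct step
    where
    distinct : Unique (x ∷ y ∷ z ∷ w ∷ [])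
    distinct = ((λ e → irr e xy) ∷ x≢z ∷ (λ e → irr (sym e) wx) ∷ [])
             ∷ ((λ e → irr e yz) ∷ y≢w ∷ []) ∷ ((λ e → irr e zw) ∷ []) ∷ [] ∷ []

    step : ∀ i → G (lookup (x ∷ y ∷ z ∷ w ∷ []) i) (lookup (x ∷ y ∷ z ∷ w ∷ []) (next i))
    step zero                   = xy
    step (suc zero)             = yz
    step (suc (suc zero))       = zw
    step (suc (suc (suc zero))) = wx

  bipartite-triangle-free : (side : W → Fin 2) → (∀ x y → G x y → side x ≢ side y) →
                            ¬ ContainsCopy G (Cycle 3)
  bipartite-triangle-free side crosses (f , _ , f-edge)
    with i , j , i<j , same ← pigeonhole (s≤s (s≤s (s≤s z≤n))) (side ∘ f)
    = crosses (f i) (f j) (f-edge i j (cycle3-complete (<⇒≢ i<j))) same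

  -- A 4-cycle gives either a non-centre with two distinct neighbours or two adjacent centres.
  star-forest-C4-free : (centre : W → Set) → Decidable centre →
                        (∀ {x y} → centre x → centre y → ¬ G x y) →
                        (∀ x y z → ¬ centre y → G x y → G z y → x ≡ z) →
                        ¬ ContainsCopy G (Cycle 4)
  star-forest-C4-free centre centre? independent unique-neighbour (f , f-inj , f-edge)
    with centre? (f zero)
  ... | no f₀∉ = case f-inj (unique-neighbour _ _ _ f₀∉ (f-edge (suc zero) zero (inj₂ refl))
                                                  (f-edge (suc (suc (suc zero))) zero (inj₁ refl))) of λ ()
  ... | yes f₀∈ = case f-inj (unique-neighbour _ _ _ (λ f₁∈ → independent f₀∈ f₁∈ f₀f₁) f₀f₁
                                               (f-edge (suc (suc zero)) (suc zero) (inj₂ refl))) of λ ()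
    where
    f₀f₁ : G (f zero) (f (suc zero))
    f₀f₁ = f-edge zero (suc zero) (inj₁ refl)

  matching-empty : ContainsCopy G (Matching 0)
  matching-empty = (λ { (() , _) }) , (λ { {() , _} }) , λ { (() , _) }

  matching-extend : ∀ {n u v} → Symmetric G → G u v → u ≢ v →
                    (M : ContainsCopy G (Matching n)) → (∀ x → proj₁ M x ≢ u × proj₁ M x ≢ v) →
                    ContainsCopy G (Matching (suc n))
  matching-extend {n} {u} {v} G-sym uv u≢v (f , f-inj , f-edge) fresh = F , F-inj , F-edge
    where
    F : Fin (suc n) × Fin 2 → W
    F (zero , zero)     = u
    F (zero , suc zero) = v
    F (suc m , a)       = f (m , a)

    F-inj : Injective _≡_ _≡_ F
    F-inj {zero , zero}     {zero , zero}     _ = refl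
    F-inj {zero , suc zero} {zero , suc zero} _ = refl
    F-inj {zero , zero}     {zero , suc zero} e = ⊥-elim (u≢v e)
    F-inj {zero , suc zero} {zero , zero}     e = ⊥-elim (u≢v (sym e))
    F-inj {zero , zero}     {suc m , a}       e = ⊥-elim (proj₁ (fresh (m , a)) (sym e))
    F-inj {zero , suc zero} {suc m , a}       e = ⊥-elim (proj₂ (fresh (m , a)) (sym e))
    F-inj {suc m , a}       {zero , zero}     e = ⊥-elim (proj₁ (fresh (m , a)) e)
    F-inj {suc m , a}       {zero , suc zero} e = ⊥-elim (proj₂ (fresh (m , a)) e)
    F-inj {suc m , a}       {suc m' , b}      e with refl ← f-inj e = refl

    F-edge : ∀ x y → E (Matching (suc n)) x y → G (F x) (F y)
    F-edge (zero , zero)     (zero , zero)     (_ , a≢b) = ⊥-elim (a≢b refl)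
    F-edge (zero , suc zero) (zero , suc zero) (_ , a≢b) = ⊥-elim (a≢b refl)
    F-edge (zero , zero)     (zero , suc zero) _         = uv
    F-edge (zero , suc zero) (zero , zero)     _         = G-sym uv
    F-edge (zero , _)        (suc _ , _)       (() , _)
    F-edge (suc _ , _)       (zero , _)        (() , _)
    F-edge (suc m , a)       (suc m , b)       (refl , a≢b) = f-edge (m , a) (m , b) (refl , a≢b)

  single-edge-matching : ∀ {u v} → Symmetric G → G u v → u ≢ v → ContainsCopy G (Matching 1)
  single-edge-matching G-sym uv u≢v = matching-extend G-sym uv u≢v matching-empty λ { (() , _) }

  matching-has-edge : ∀ {n} → ContainsCopy G (Matching (suc n)) → Σ W λ u → Σ W λ v → G u v
  matching-has-edge (f , _ , f-edge) = f (zero , zero) , f (zero , suc zero) , f-edge _ _ (refl , λ ())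

  cover-bounds-matching : ∀ {k n} (ι : Fin k → W) →
                          (∀ x y → G x y → Σ (Fin k) λ i → x ≡ ι i ⊎ y ≡ ι i) →
                          k < n → ¬ ContainsCopy G (Matching n)
  cover-bounds-matching {k} {n} ι covers k<n (f , f-inj , f-edge) =
    collision (pigeonhole k<n (proj₁ ∘ coverOf))
    where
    coverOf : ∀ m → Σ (Fin k) λ i → Σ (Fin 2) λ a → f (m , a) ≡ ι i
    coverOf m with covers _ _ (f-edge (m , zero) (m , suc zero) (refl , λ ()))
    ... | i , inj₁ e = i , zero , e
    ... | i , inj₂ e = i , suc zero , e

    collision : (∃₂ λ m m' → m Fin.< m' × proj₁ (coverOf m) ≡ proj₁ (coverOf m')) → ⊥
    collision (m , m' , m<m' , same) =
      <⇒≢ m<m' (cong proj₁ (f-inj (trans (proj₂ (proj₂ (coverOf m)))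
                                  (trans (cong ι same) (sym (proj₂ (proj₂ (coverOf m'))))))))

module _ {k j t} (c : Colouring k j t) (ℓ : Fin k) where

  colourClass-sym : Symmetric (ColourClass c ℓ)
  colourClass-sym {u} {v} (u≁v , uv) = u≁v ∘ sym , trans (symm c v u) uv

  colourClass-irrefl : Irreflexive _≡_ (ColourClass c ℓ)
  colourClass-irrefl refl (u≁u , _) = u≁u refl

liftKV : ∀ {j s t} → (Fin j → Fin s → Fin t) → KV j s → KV j t
liftKV σ u = proj₁ u , σ (proj₁ u) (proj₂ u)

liftKV-injective : ∀ {j s t} {σ : Fin j → Fin s → Fin t} →
                   (∀ p → Injective _≡_ _≡_ (σ p)) → Injective _≡_ _≡_ (liftKV σ)
liftKV-injective σ-inj {p , i} {q , i'} e with refl ← ,-injectiveˡ e =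
  cong (p ,_) (σ-inj p (,-injectiveʳ e))

restrict : ∀ {k j s t} → Colouring k j t → (Fin j → Fin s → Fin t) → Colouring k j s
restrict c σ = record { col = λ u v → col c (liftKV σ u) (liftKV σ v) ; symm = λ u v → symm c _ _ }

prefix : ∀ {j m} n → Fin j → Fin m → Fin (m + n)
prefix n _ i = i ↑ˡ n

prefix-injective : ∀ {j m} n (p : Fin j) → Injective _≡_ _≡_ (prefix {j} {m} n p)
prefix-injective n _ = ↑ˡ-injective n _ _

copy-restrict : ∀ {k j s t} (c : Colouring k j t) {σ : Fin j → Fin s → Fin t} {ℓ H} →
                (∀ p → Injective _≡_ _≡_ (σ p)) →
                ContainsCopy (ColourClass (restrict c σ) ℓ) H → ContainsCopy (ColourClass c ℓ) H
copy-restrict c {σ} σ-inj (f , f-inj , f-edge) = liftKV σ ∘ f , f-inj ∘ liftKV-injective σ-inj , f-edge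

module _ {j t} (u v : KV j (suc t)) where

  hole : Fin j → Fin (suc t)
  hole p with p ≟ proj₁ u | p ≟ proj₁ v
  ... | yes _ | _     = proj₂ u
  ... | no _  | yes _ = proj₂ v
  ... | no _  | no _  = zero

  hole-left : hole (proj₁ u) ≡ proj₂ u
  hole-left with proj₁ u ≟ proj₁ u
  ... | yes _ = refl
  ... | no ≢u = ⊥-elim (≢u refl)

  hole-right : proj₁ u ≢ proj₁ v → hole (proj₁ v) ≡ proj₂ v
  hole-right u≁v with proj₁ v ≟ proj₁ u | proj₁ v ≟ proj₁ v
  ... | yes e | _     = ⊥-elim (u≁v (sym e))
  ... | no _  | yes _ = refl
  ... | no _  | no ≢v = ⊥-elim (≢v refl)

  omitting : Fin j → Fin t → Fin (suc t)
  omitting p = punchIn (hole p)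

  omitting-injective : ∀ p → Injective _≡_ _≡_ (omitting p)
  omitting-injective p = punchIn-injective (hole p) _ _

  omitting-avoids : proj₁ u ≢ proj₁ v → ∀ w → liftKV omitting w ≢ u × liftKV omitting w ≢ v
  omitting-avoids u≁v w = misses hole-left w , misses (hole-right u≁v) w
    where
    misses : ∀ {x} → hole (proj₁ x) ≡ proj₂ x → ∀ w → liftKV omitting w ≢ x
    misses hx (p , i) refl = punchInᵢ≢i (hole p) i (sym hx)

-- The case K_{3×3}

a₀ a₁ a₂ b₀ b₁ b₂ c₀ c₁ c₂ : KV 3 3
a₀ = zero , zero
a₁ = zero , suc zero
a₂ = zero , suc (suc zero)
b₀ = suc zero , zero
b₁ = suc zero , suc zero
b₂ = suc zero , suc (suc zero)
c₀ = suc (suc zero) , zero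
c₁ = suc (suc zero) , suc zero
c₂ = suc (suc zero) , suc (suc zero)

Fact : Set
Fact = KV 3 3 × KV 3 3 × Fin 3

KnownEdge : List Fact → Fin 3 → KV 3 3 → KV 3 3 → Set
KnownEdge ρ ℓ x y = KAdj 3 3 x y × ((x , y , ℓ) ∈ ρ ⊎ (y , x , ℓ) ∈ ρ)

-- A case split on the colour of xy; a green xy needs no further argument.
data Certificate : Set where
  △     : (x y z : KV 3 3) → Certificate
  □     : (x y z w : KV 3 3) → Certificate
  split : (x y : KV 3 3) → (ifRed ifBlue : Certificate) → Certificate

Closes : Certificate → List Fact → Set
Closes (△ x y z)       ρ = KnownEdge ρ red x y × KnownEdge ρ red y z × KnownEdge ρ red z x
Closes (□ x y z w)     ρ = KnownEdge ρ blue x y × KnownEdge ρ blue y z × KnownEdge ρ blue z w ×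
                           KnownEdge ρ blue w x × x ≢ z × y ≢ w
Closes (split x y l r) ρ = KAdj 3 3 x y × Closes l ((x , y , red) ∷ ρ) × Closes r ((x , y , blue) ∷ ρ)

_≟ᵥ_ : DecidableEquality (KV 3 3)
_≟ᵥ_ = ≡-dec _≟_ _≟_

_≟ᶠ_ : DecidableEquality Fact
_≟ᶠ_ = ≡-dec _≟ᵥ_ (≡-dec _≟ᵥ_ _≟_)

open import Data.List.Membership.DecPropositional _≟ᶠ_ using (_∈?_)

knownEdge? : ∀ ρ ℓ x y → Dec (KnownEdge ρ ℓ x y)
knownEdge? ρ ℓ x y = ¬? (proj₁ x ≟ proj₁ y) ×-dec ((x , y , ℓ) ∈? ρ ⊎-dec (y , x , ℓ) ∈? ρ)

closes? : ∀ t ρ → Dec (Closes t ρ)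
closes? (△ x y z) ρ = knownEdge? ρ red x y ×-dec knownEdge? ρ red y z ×-dec knownEdge? ρ red z x
closes? (□ x y z w) ρ =
  knownEdge? ρ blue x y ×-dec knownEdge? ρ blue y z ×-dec knownEdge? ρ blue z w ×-dec
  knownEdge? ρ blue w x ×-dec ¬? (x ≟ᵥ z) ×-dec ¬? (y ≟ᵥ w)
closes? (split x y l r) ρ = ¬? (proj₁ x ≟ proj₁ y) ×-dec closes? l _ ×-dec closes? r _

module _ (c : Colouring 3 3 3) where

  Holds : Fact → Set
  Holds (x , y , ℓ) = col c x y ≡ ℓ

  knownEdge-sound : ∀ {ρ ℓ x y} → All Holds ρ → KnownEdge ρ ℓ x y → ColourClass c ℓ x y
  knownEdge-sound facts (x≁y , inj₁ xy∈) = x≁y , All.lookup facts xy∈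
  knownEdge-sound facts (x≁y , inj₂ yx∈) = x≁y , trans (symm c _ _) (All.lookup facts yx∈)

  closes-sound : ∀ t ρ → Closes t ρ → All Holds ρ →
                 Σ (Fin 3) λ ℓ → ContainsCopy (ColourClass c ℓ) (C3C4nK2 1 ℓ)
  closes-sound (△ x y z) ρ (xy , yz , zx) facts =
    red , triangle-copy (colourClass-sym c red) (colourClass-irrefl c red) (known xy) (known yz) (known zx)
    where
    known : ∀ {x y} → KnownEdge ρ red x y → ColourClass c red x y
    known = knownEdge-sound facts
  closes-sound (□ x y z w) ρ (xy , yz , zw , wx , x≢z , y≢w) facts =
    blue , square-copy (colourClass-sym c blue) (colourClass-irrefl c blue)
                       (known xy) (known yz) (known zw) (known wx) x≢z y≢w
    where
    known : ∀ {x y} → KnownEdge ρ blue x y → ColourClass c blue x y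
    known = knownEdge-sound facts
  closes-sound (split x y l r) ρ (x≁y , l-closes , r-closes) facts with col c x y in xy
  ... | red   = closes-sound l _ l-closes (xy ∷ facts)
  ... | blue  = closes-sound r _ r-closes (xy ∷ facts)
  ... | green =
    green , single-edge-matching {u = x} {v = y} (colourClass-sym c green) (x≁y , xy) (x≁y ∘ cong proj₁)

certificate : Certificate
certificate =
  split a₂ b₁ (split b₁ c₀ (split a₂ c₀ (△ a₂ b₁ c₀) (split a₀ c₀ (split a₀ b₁ (△ a₀ b₁ c₀) (split
  a₂ c₂ (split b₁ c₂ (△ a₂ b₁ c₂) (split b₀ c₂ (split a₂ b₀ (△ a₂ b₀ c₂) (split a₀ b₀ (split a₀ c₂
  (△ a₀ b₀ c₂) (split b₀ c₀ (△ a₀ b₀ c₀) (split a₁ b₁ (split a₁ c₀ (△ a₁ b₁ c₀) (split a₁ b₀ (split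
  a₁ c₂ (△ a₁ b₀ c₂) (split a₁ c₁ (split b₁ c₁ (△ a₁ b₁ c₁) (split b₀ c₁ (△ a₁ b₀ c₁) (split a₀ c₁
  (split a₂ c₁ (split b₂ c₁ (split a₂ b₂ (△ a₂ b₂ c₁) (split a₁ b₂ (△ a₁ b₂ c₁) (□ a₁ b₂ a₂ c₀)))
  (split b₂ c₂ (split a₂ b₂ (△ a₂ b₂ c₂) (□ a₂ b₀ c₁ b₂)) (□ b₁ c₁ b₂ c₂))) (□ a₂ c₀ b₀ c₁)) (□ a₀
  c₁ b₁ c₂)))) (split a₀ c₁ (split b₀ c₁ (△ a₀ b₀ c₁) (□ a₁ c₀ b₀ c₁)) (□ a₀ c₁ a₁ c₂)))) (□ a₁ b₀
  a₂ c₀))) (split a₁ c₂ (split a₁ b₀ (△ a₁ b₀ c₂) (split a₁ c₀ (split a₁ b₂ (split b₂ c₂ (△ a₁ b₂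
  c₂) (split b₂ c₀ (△ a₁ b₂ c₀) (split a₂ b₂ (split a₀ b₂ (split b₂ c₁ (split a₀ c₁ (△ a₀ b₂ c₁)
  (split a₁ c₁ (△ a₁ b₂ c₁) (□ a₀ b₁ a₁ c₁))) (split b₁ c₁ (split a₂ c₁ (△ a₂ b₁ c₁) (□ a₂ c₀ b₂
  c₁)) (□ b₁ c₁ b₂ c₂))) (□ a₀ b₁ c₂ b₂)) (□ a₂ b₀ c₀ b₂)))) (split a₂ b₂ (split b₂ c₂ (△ a₂ b₂ c₂)
  (□ a₁ b₁ c₂ b₂)) (□ a₁ b₀ a₂ b₂))) (□ a₁ b₀ a₂ c₀))) (□ a₀ b₁ a₁ c₂))))) (split a₁ b₀ (split a₁
  c₂ (△ a₁ b₀ c₂) (split a₀ b₂ (split b₂ c₀ (△ a₀ b₂ c₀) (split b₂ c₁ (split a₀ c₁ (△ a₀ b₂ c₁)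
  (split a₂ c₁ (split b₁ c₁ (△ a₂ b₁ c₁) (split a₁ c₁ (split b₀ c₁ (△ a₁ b₀ c₁) (□ a₀ b₀ c₁ b₁)) (□
  a₁ c₁ b₁ c₂))) (□ a₀ b₀ a₂ c₁))) (split a₂ c₁ (split b₁ c₁ (△ a₂ b₁ c₁) (split b₂ c₂ (split a₀ c₂
  (△ a₀ b₂ c₂) (split a₂ b₂ (△ a₂ b₂ c₂) (split b₀ c₁ (split a₁ c₁ (△ a₁ b₀ c₁) (□ a₁ c₁ b₁ c₂)) (□
  a₀ b₀ c₁ b₁)))) (□ b₁ c₁ b₂ c₂))) (□ a₂ c₀ b₂ c₁)))) (split a₂ b₂ (split b₂ c₂ (△ a₂ b₂ c₂) (□ a₀
  b₁ c₂ b₂)) (□ a₀ b₀ a₂ b₂)))) (split a₁ b₁ (split a₁ c₀ (△ a₁ b₁ c₀) (□ a₁ b₀ a₂ c₀)) (□ a₀ b₀ a₁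
  b₁))))) (split a₀ b₀ (split b₀ c₀ (△ a₀ b₀ c₀) (split b₂ c₂ (split a₂ b₂ (△ a₂ b₂ c₂) (split b₀
  c₁ (split a₀ c₁ (△ a₀ b₀ c₁) (split a₁ b₂ (split a₁ c₂ (△ a₁ b₂ c₂) (split a₁ c₀ (split a₁ b₁ (△
  a₁ b₁ c₀) (split a₁ c₁ (split a₁ b₀ (△ a₁ b₀ c₁) (□ a₁ b₀ c₂ b₁)) (□ a₀ b₁ a₁ c₁))) (□ a₁ c₀ b₀
  c₂))) (split a₁ c₀ (split a₁ b₁ (△ a₁ b₁ c₀) (split a₀ b₂ (split a₀ c₂ (△ a₀ b₂ c₂) (split b₂ c₀
  (△ a₀ b₂ c₀) (split a₁ b₀ (split a₁ c₁ (△ a₁ b₀ c₁) (□ a₀ b₁ a₁ c₁)) (□ a₁ b₀ c₀ b₂)))) (□ a₀ b₁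
  a₁ b₂))) (□ a₁ b₂ a₂ c₀)))) (split b₁ c₁ (split a₂ c₁ (△ a₂ b₁ c₁) (□ a₂ c₀ b₀ c₁)) (□ b₀ c₁ b₁
  c₂)))) (split b₂ c₀ (split a₀ b₂ (△ a₀ b₂ c₀) (□ a₀ b₁ c₂ b₂)) (□ b₀ c₀ b₂ c₂)))) (□ a₀ b₀ c₂
  b₁)))) (split a₂ c₁ (split b₁ c₁ (△ a₂ b₁ c₁) (split a₀ b₂ (split b₂ c₀ (△ a₀ b₂ c₀) (split b₂ c₂
  (split a₀ c₂ (△ a₀ b₂ c₂) (split a₁ c₂ (split a₁ b₂ (△ a₁ b₂ c₂) (split a₁ b₀ (split b₀ c₂ (△ a₁
  b₀ c₂) (split b₀ c₀ (split a₀ b₀ (△ a₀ b₀ c₀) (split b₀ c₁ (split a₂ b₀ (△ a₂ b₀ c₁) (□ a₀ b₀ a₂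
  c₂)) (□ a₀ b₀ c₁ b₁))) (□ a₂ c₀ b₀ c₂))) (split b₀ c₀ (split a₀ b₀ (△ a₀ b₀ c₀) (split a₁ b₁
  (split b₁ c₂ (△ a₁ b₁ c₂) (split a₁ c₀ (△ a₁ b₁ c₀) (split a₂ b₀ (split b₀ c₁ (△ a₂ b₀ c₁) (□ a₀
  b₀ c₁ b₁)) (□ a₀ b₀ a₂ c₂)))) (□ a₀ b₀ a₁ b₁))) (□ a₁ b₀ c₀ b₂)))) (split a₁ c₀ (split a₁ b₁ (△
  a₁ b₁ c₀) (□ a₀ b₁ a₁ c₂)) (□ a₁ c₀ a₂ c₂)))) (□ a₂ c₀ b₂ c₂))) (split b₂ c₁ (split a₂ b₂ (△ a₂
  b₂ c₁) (split a₀ c₂ (split a₀ b₀ (split b₀ c₂ (△ a₀ b₀ c₂) (split b₀ c₀ (△ a₀ b₀ c₀) (□ a₂ c₀ b₀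
  c₂))) (split b₀ c₁ (split a₂ b₀ (△ a₂ b₀ c₁) (□ a₀ b₀ a₂ b₂)) (□ a₀ b₀ c₁ b₁))) (□ a₀ b₂ a₂ c₂)))
  (□ a₀ b₁ c₁ b₂)))) (split a₁ c₀ (split a₁ b₁ (△ a₁ b₁ c₀) (split b₂ c₀ (split a₁ b₂ (△ a₁ b₂ c₀)
  (split a₀ b₂ (△ a₀ b₂ c₀) (□ a₀ b₁ a₁ b₂))) (split b₂ c₂ (split b₂ c₁ (split b₀ c₀ (split a₁ b₀
  (△ a₁ b₀ c₀) (split a₀ b₀ (△ a₀ b₀ c₀) (□ a₀ b₀ a₁ b₁))) (split b₀ c₂ (split b₀ c₁ (split a₀ c₂
  (split a₀ b₂ (△ a₀ b₂ c₂) (split a₀ b₀ (△ a₀ b₀ c₂) (□ a₀ b₀ c₀ b₂))) (split a₁ c₂ (split a₁ b₀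
  (△ a₁ b₀ c₂) (split a₁ b₂ (△ a₁ b₂ c₂) (□ a₁ b₀ c₀ b₂))) (□ a₀ b₁ a₁ c₂))) (□ a₂ c₀ b₀ c₁)) (□ a₂
  c₀ b₀ c₂))) (□ a₂ c₀ b₂ c₁)) (□ a₂ c₀ b₂ c₂)))) (split a₁ c₂ (split a₁ c₁ (split a₁ b₀ (split b₀
  c₂ (△ a₁ b₀ c₂) (split b₀ c₁ (△ a₁ b₀ c₁) (□ a₂ c₁ b₀ c₂))) (split a₂ b₀ (split a₁ b₂ (split b₂
  c₂ (△ a₁ b₂ c₂) (split b₂ c₁ (△ a₁ b₂ c₁) (□ a₂ c₁ b₂ c₂))) (split a₂ b₂ (split a₁ b₁ (split b₁
  c₂ (△ a₁ b₁ c₂) (split b₁ c₁ (△ a₁ b₁ c₁) (□ a₂ c₁ b₁ c₂))) (split a₀ b₂ (split b₂ c₀ (△ a₀ b₂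
  c₀) (split b₂ c₂ (split a₀ b₀ (split b₀ c₀ (△ a₀ b₀ c₀) (□ a₁ b₀ c₀ b₂)) (□ a₀ b₀ a₁ b₁)) (□ a₂
  c₀ b₂ c₂))) (□ a₀ b₁ a₁ b₂))) (□ a₁ b₂ a₂ c₀))) (□ a₁ b₀ a₂ c₀))) (□ a₁ c₀ a₂ c₁)) (□ a₁ c₀ a₂
  c₂)))))) (split a₁ c₀ (split a₁ b₁ (△ a₁ b₁ c₀) (split a₂ c₂ (split b₁ c₂ (△ a₂ b₁ c₂) (split b₀
  c₂ (split a₂ b₀ (△ a₂ b₀ c₂) (split a₀ b₀ (split a₀ c₂ (△ a₀ b₀ c₂) (split a₀ c₁ (split b₀ c₁ (△
  a₀ b₀ c₁) (split b₂ c₁ (split a₀ b₂ (△ a₀ b₂ c₁) (split a₂ b₂ (split b₂ c₂ (△ a₂ b₂ c₂) (split a₁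
  b₂ (split b₂ c₀ (△ a₁ b₂ c₀) (□ a₀ c₀ b₂ c₂)) (□ a₁ b₁ c₂ b₂))) (□ a₀ b₂ a₂ c₀))) (split a₂ b₂
  (split b₂ c₂ (△ a₂ b₂ c₂) (split b₁ c₁ (split a₀ b₁ (△ a₀ b₁ c₁) (split a₂ c₁ (△ a₂ b₁ c₁) (split
  b₂ c₀ (split a₁ b₂ (△ a₁ b₂ c₀) (□ a₁ b₁ c₂ b₂)) (□ a₀ c₀ b₂ c₂)))) (□ b₁ c₁ b₂ c₂))) (□ a₂ b₀ c₁
  b₂)))) (split a₂ c₁ (split b₁ c₁ (△ a₂ b₁ c₁) (□ a₀ c₁ b₁ c₂)) (□ a₀ c₀ a₂ c₁)))) (□ a₀ b₀ a₂
  c₀))) (split a₁ b₀ (split b₀ c₀ (△ a₁ b₀ c₀) (split a₀ c₂ (split b₂ c₂ (split a₀ b₂ (△ a₀ b₂ c₂)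
  (split a₂ b₂ (△ a₂ b₂ c₂) (□ a₀ b₂ a₂ c₀))) (split a₁ b₂ (split b₂ c₀ (△ a₁ b₂ c₀) (□ b₀ c₀ b₂
  c₂)) (□ a₁ b₁ c₂ b₂))) (□ a₀ c₀ b₀ c₂))) (□ a₁ b₀ c₂ b₁)))) (split a₀ c₂ (split a₂ c₁ (split b₁
  c₁ (△ a₂ b₁ c₁) (split a₁ b₀ (split b₀ c₀ (△ a₁ b₀ c₀) (split b₀ c₂ (split a₀ b₀ (△ a₀ b₀ c₂)
  (split a₂ b₀ (split b₀ c₁ (△ a₂ b₀ c₁) (split a₀ b₁ (split b₁ c₂ (△ a₀ b₁ c₂) (split a₁ c₂ (△ a₁
  b₀ c₂) (split a₀ c₁ (split a₁ c₁ (split b₂ c₁ (split a₁ b₂ (△ a₁ b₂ c₁) (split a₂ b₂ (△ a₂ b₂ c₁)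
  (□ a₁ b₂ a₂ c₂))) (split b₂ c₂ (split a₀ b₂ (△ a₀ b₂ c₂) (□ a₀ b₀ c₁ b₂)) (□ b₁ c₁ b₂ c₂))) (□ a₁
  c₁ b₁ c₂)) (□ a₀ c₀ b₀ c₁)))) (□ a₀ b₀ c₁ b₁))) (□ a₀ b₀ a₂ c₀))) (□ a₂ c₀ b₀ c₂))) (split b₀ c₁
  (split a₂ b₀ (△ a₂ b₀ c₁) (split a₀ b₀ (split b₀ c₂ (△ a₀ b₀ c₂) (split b₁ c₂ (split a₀ b₁ (△ a₀
  b₁ c₂) (split a₀ c₁ (△ a₀ b₀ c₁) (split a₁ c₂ (split a₁ c₁ (split b₀ c₀ (split a₁ b₂ (split b₂ c₂
  (△ a₁ b₂ c₂) (split b₂ c₀ (△ a₁ b₂ c₀) (□ a₂ c₀ b₂ c₂))) (split b₂ c₂ (split a₀ b₂ (△ a₀ b₂ c₂)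
  (□ a₀ b₁ a₁ b₂)) (□ a₁ b₀ c₂ b₂))) (□ a₂ c₀ b₀ c₂)) (□ a₀ b₁ a₁ c₁)) (□ a₁ b₀ a₂ c₂)))) (□ a₁ b₀
  c₂ b₁))) (□ a₀ b₀ a₂ c₀))) (□ a₁ b₀ c₁ b₁)))) (split a₀ c₁ (split a₀ b₂ (split b₂ c₂ (△ a₀ b₂ c₂)
  (split b₂ c₁ (△ a₀ b₂ c₁) (□ a₂ c₁ b₂ c₂))) (split a₂ b₂ (split a₀ b₀ (split b₀ c₂ (△ a₀ b₀ c₂)
  (split b₀ c₁ (△ a₀ b₀ c₁) (□ a₂ c₁ b₀ c₂))) (split a₂ b₀ (split a₀ b₁ (split b₁ c₂ (△ a₀ b₁ c₂)
  (split b₁ c₁ (△ a₀ b₁ c₁) (□ a₂ c₁ b₁ c₂))) (split a₁ b₀ (split b₀ c₀ (△ a₁ b₀ c₀) (split b₀ c₂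
  (split a₁ b₂ (split b₂ c₀ (△ a₁ b₂ c₀) (□ a₀ b₀ c₀ b₂)) (□ a₀ b₁ a₁ b₂)) (□ a₂ c₀ b₀ c₂))) (□ a₀
  b₀ a₁ b₁))) (□ a₀ b₀ a₂ c₀))) (□ a₀ b₂ a₂ c₀))) (□ a₀ c₀ a₂ c₁))) (□ a₀ c₀ a₂ c₂)))) (split a₂ c₂
  (split b₁ c₂ (△ a₂ b₁ c₂) (split a₂ c₁ (split b₁ c₁ (△ a₂ b₁ c₁) (split a₂ b₂ (split b₂ c₂ (△ a₂
  b₂ c₂) (split b₂ c₁ (△ a₂ b₂ c₁) (□ b₁ c₁ b₂ c₂))) (split a₁ b₂ (split a₀ b₂ (split a₂ b₀ (split
  b₀ c₂ (△ a₂ b₀ c₂) (split b₀ c₁ (△ a₂ b₀ c₁) (□ b₀ c₁ b₁ c₂))) (split a₁ b₀ (split a₀ b₀ (split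
  b₀ c₂ (split a₀ c₂ (△ a₀ b₀ c₂) (split a₁ c₂ (△ a₁ b₀ c₂) (□ a₀ c₀ a₁ c₂))) (split b₀ c₁ (split
  a₀ c₁ (△ a₀ b₀ c₁) (split a₁ c₁ (△ a₁ b₀ c₁) (□ a₀ c₀ a₁ c₁))) (□ b₀ c₁ b₁ c₂))) (□ a₀ b₀ a₂ c₀))
  (□ a₁ b₀ a₂ c₀))) (□ a₀ b₂ a₂ c₀)) (□ a₁ b₂ a₂ c₀)))) (split a₀ c₁ (split a₁ c₁ (split b₂ c₁
  (split a₁ b₂ (△ a₁ b₂ c₁) (split a₀ b₂ (△ a₀ b₂ c₁) (□ a₀ b₂ a₁ c₀))) (split b₂ c₀ (split b₀ c₁
  (split a₁ b₀ (△ a₁ b₀ c₁) (split a₀ b₀ (△ a₀ b₀ c₁) (□ a₀ b₀ a₁ c₀))) (split b₀ c₀ (split b₁ c₁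
  (split a₁ b₁ (△ a₁ b₁ c₁) (split a₀ b₁ (△ a₀ b₁ c₁) (□ a₀ b₁ a₁ c₀))) (split b₀ c₂ (split a₂ b₀
  (△ a₂ b₀ c₂) (split a₁ b₀ (split b₂ c₂ (split a₂ b₂ (△ a₂ b₂ c₂) (□ a₂ b₀ c₁ b₂)) (□ b₁ c₁ b₂
  c₂)) (□ a₁ b₀ a₂ c₀))) (□ b₀ c₁ b₁ c₂))) (□ a₂ c₀ b₀ c₁))) (□ a₂ c₀ b₂ c₁))) (□ a₁ c₀ a₂ c₁)) (□
  a₀ c₀ a₂ c₁)))) (split a₀ c₂ (split a₁ c₂ (split a₂ c₁ (split b₁ c₁ (△ a₂ b₁ c₁) (split b₀ c₂
  (split a₁ b₀ (△ a₁ b₀ c₂) (split a₀ b₀ (△ a₀ b₀ c₂) (□ a₀ b₀ a₁ c₀))) (split b₀ c₀ (split b₂ c₂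
  (split a₁ b₂ (△ a₁ b₂ c₂) (split a₀ b₂ (△ a₀ b₂ c₂) (□ a₀ b₂ a₁ c₀))) (split b₂ c₀ (split b₁ c₂
  (split a₁ b₁ (△ a₁ b₁ c₂) (split a₀ b₁ (△ a₀ b₁ c₂) (□ a₀ b₁ a₁ c₀))) (split b₂ c₁ (split a₂ b₂
  (△ a₂ b₂ c₁) (split a₁ b₂ (split b₀ c₁ (split a₂ b₀ (△ a₂ b₀ c₁) (□ a₂ b₀ c₂ b₂)) (□ b₀ c₁ b₁
  c₂)) (□ a₁ b₂ a₂ c₀))) (□ b₁ c₁ b₂ c₂))) (□ a₂ c₀ b₂ c₂))) (□ a₂ c₀ b₀ c₂)))) (split a₀ c₁ (split
  a₁ c₁ (split b₀ c₂ (split a₁ b₀ (△ a₁ b₀ c₂) (split a₀ b₀ (△ a₀ b₀ c₂) (□ a₀ b₀ a₁ c₀))) (split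
  b₀ c₁ (split a₁ b₀ (△ a₁ b₀ c₁) (split a₀ b₀ (△ a₀ b₀ c₁) (□ a₀ b₀ a₁ c₀))) (□ a₂ c₁ b₀ c₂))) (□
  a₁ c₀ a₂ c₁)) (□ a₀ c₀ a₂ c₁))) (□ a₁ c₀ a₂ c₂)) (□ a₀ c₀ a₂ c₂)))))) (split b₁ c₂ (split a₂ c₂
  (△ a₂ b₁ c₂) (split a₂ c₁ (split b₁ c₁ (△ a₂ b₁ c₁) (split b₂ c₁ (split a₂ b₂ (△ a₂ b₂ c₁) (split
  a₁ b₂ (split a₁ c₁ (△ a₁ b₂ c₁) (split a₁ c₀ (split b₂ c₀ (△ a₁ b₂ c₀) (split b₀ c₀ (split a₁ b₀
  (△ a₁ b₀ c₀) (split a₀ c₂ (split a₀ b₁ (△ a₀ b₁ c₂) (split a₀ b₂ (split a₀ c₁ (△ a₀ b₂ c₁) (split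
  a₀ b₀ (split a₀ c₀ (△ a₀ b₀ c₀) (□ a₀ c₀ b₁ c₁)) (□ a₀ b₀ a₁ c₁))) (□ a₀ b₁ c₀ b₂))) (split a₀ b₂
  (split a₀ c₁ (△ a₀ b₂ c₁) (split a₁ c₂ (split a₁ b₁ (△ a₁ b₁ c₂) (split b₂ c₂ (△ a₁ b₂ c₂) (split
  a₀ c₀ (split a₀ b₀ (△ a₀ b₀ c₀) (□ a₀ b₀ a₁ c₁)) (□ a₀ c₀ b₁ c₁)))) (□ a₀ c₁ a₁ c₂))) (□ a₀ b₂ a₂
  c₂)))) (split b₀ c₁ (split a₂ b₀ (△ a₂ b₀ c₁) (□ a₂ b₀ c₀ b₂)) (□ b₀ c₀ b₁ c₁)))) (□ a₁ c₀ b₁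
  c₁))) (split a₁ c₂ (split a₁ b₁ (△ a₁ b₁ c₂) (split b₂ c₀ (split a₀ b₂ (split a₀ c₀ (△ a₀ b₂ c₀)
  (split a₀ c₁ (△ a₀ b₂ c₁) (□ a₀ c₀ b₁ c₁))) (split a₀ c₂ (split a₀ b₁ (△ a₀ b₁ c₂) (□ a₀ b₁ a₁
  b₂)) (□ a₀ b₂ a₂ c₂))) (□ a₁ b₁ c₀ b₂))) (□ a₁ b₂ a₂ c₂)))) (split b₂ c₀ (split b₀ c₁ (split a₂
  b₀ (△ a₂ b₀ c₁) (split a₀ c₂ (split a₀ b₁ (△ a₀ b₁ c₂) (split a₀ b₂ (split a₀ c₀ (△ a₀ b₂ c₀)
  (split a₀ c₁ (split a₀ b₀ (△ a₀ b₀ c₁) (split a₂ c₀ (split a₂ b₂ (△ a₂ b₂ c₀) (split b₂ c₂ (△ a₀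
  b₂ c₂) (split b₀ c₂ (split b₀ c₀ (split a₁ b₀ (split a₁ c₂ (△ a₁ b₀ c₂) (split a₁ c₁ (△ a₁ b₀ c₁)
  (□ a₁ c₁ b₂ c₂))) (split a₁ b₁ (split a₁ c₂ (△ a₁ b₁ c₂) (□ a₁ b₀ a₂ c₂)) (□ a₀ b₀ a₁ b₁))) (□ a₀
  b₀ c₀ b₁)) (□ a₂ b₀ c₂ b₂)))) (□ a₀ b₀ a₂ c₀))) (□ a₀ c₀ b₁ c₁))) (□ a₀ b₁ c₁ b₂))) (split a₀ b₀
  (split a₀ c₁ (△ a₀ b₀ c₁) (split a₀ c₀ (split a₀ b₂ (△ a₀ b₂ c₀) (split a₂ b₂ (split a₂ c₀ (△ a₂
  b₂ c₀) (split b₀ c₀ (△ a₀ b₀ c₀) (split b₀ c₂ (split b₂ c₂ (split a₀ b₁ (split a₁ c₂ (split a₁ b₀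
  (△ a₁ b₀ c₂) (split a₁ b₁ (△ a₁ b₁ c₂) (□ a₁ b₀ c₀ b₁))) (split a₁ b₀ (split a₁ c₁ (△ a₁ b₀ c₁)
  (□ a₀ c₁ a₁ c₂)) (□ a₁ b₀ a₂ c₂))) (□ a₀ b₁ c₁ b₂)) (□ a₀ c₁ b₂ c₂)) (□ a₂ c₀ b₀ c₂)))) (□ a₀ b₂
  a₂ c₂))) (□ a₀ c₀ b₁ c₁))) (□ a₀ b₀ a₂ c₂)))) (split b₀ c₀ (split a₀ c₀ (split a₀ b₂ (△ a₀ b₂ c₀)
  (split a₀ b₀ (△ a₀ b₀ c₀) (□ a₀ b₀ c₁ b₂))) (split a₀ c₁ (split a₁ c₀ (split a₁ b₀ (△ a₁ b₀ c₀)
  (split a₁ b₂ (△ a₁ b₂ c₀) (□ a₁ b₀ c₁ b₂))) (split a₁ c₁ (split a₂ c₀ (split a₂ b₂ (△ a₂ b₂ c₀)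
  (split a₂ b₀ (△ a₂ b₀ c₀) (□ a₂ b₀ c₁ b₂))) (split a₀ c₂ (split a₀ b₁ (△ a₀ b₁ c₂) (split a₀ b₂
  (split a₁ c₂ (split a₁ b₁ (△ a₁ b₁ c₂) (□ a₀ b₁ a₁ c₀)) (□ a₁ c₀ a₂ c₂)) (□ a₀ b₁ c₁ b₂))) (□ a₀
  c₀ a₂ c₂))) (□ a₁ c₀ b₁ c₁))) (□ a₀ c₀ b₁ c₁))) (□ b₀ c₀ b₁ c₁))) (□ b₁ c₀ b₂ c₁)))) (split a₀ c₂
  (split a₀ b₁ (△ a₀ b₁ c₂) (split a₀ b₂ (split b₂ c₂ (△ a₀ b₂ c₂) (split b₂ c₁ (split a₀ c₁ (△ a₀
  b₂ c₁) (split a₁ c₁ (split a₁ b₂ (△ a₁ b₂ c₁) (split a₁ b₀ (split b₀ c₁ (△ a₁ b₀ c₁) (split b₀ c₂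
  (split a₀ b₀ (△ a₀ b₀ c₂) (split a₁ c₂ (△ a₁ b₀ c₂) (split b₀ c₀ (split a₁ c₀ (△ a₁ b₀ c₀) (split
  a₂ c₀ (split a₂ b₀ (△ a₂ b₀ c₀) (□ a₀ b₀ a₂ c₁)) (□ a₁ c₀ a₂ c₂))) (□ a₀ b₀ c₀ b₁)))) (□ a₂ c₁ b₀
  c₂))) (split b₀ c₂ (split a₀ b₀ (△ a₀ b₀ c₂) (split a₁ b₁ (split b₁ c₁ (△ a₁ b₁ c₁) (split a₁ c₂
  (△ a₁ b₁ c₂) (split a₀ c₀ (split b₂ c₀ (△ a₀ b₂ c₀) (split a₂ c₀ (split a₂ b₀ (split b₀ c₀ (△ a₂
  b₀ c₀) (□ a₀ b₀ c₀ b₁)) (□ a₀ b₀ a₂ c₁)) (□ a₂ c₀ b₁ c₁))) (□ a₀ c₀ b₁ c₁)))) (□ a₀ b₀ a₁ b₁)))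
  (□ a₁ b₀ c₂ b₂)))) (split a₁ c₂ (split a₁ b₁ (△ a₁ b₁ c₂) (□ a₀ b₁ a₁ c₁)) (□ a₁ c₁ a₂ c₂)))) (□
  a₂ c₁ b₂ c₂))) (split b₂ c₀ (split a₀ b₀ (split b₀ c₂ (△ a₀ b₀ c₂) (split b₀ c₁ (split a₀ c₁ (△
  a₀ b₀ c₁) (split a₂ b₂ (split a₂ c₀ (△ a₂ b₂ c₀) (split a₀ c₀ (split b₀ c₀ (△ a₀ b₀ c₀) (□ a₂ c₀
  b₀ c₂)) (□ a₀ c₀ a₂ c₁))) (□ a₀ b₂ a₂ c₁))) (□ a₂ c₁ b₀ c₂))) (split b₀ c₀ (split a₁ b₀ (split a₁
  c₀ (△ a₁ b₀ c₀) (split a₂ c₀ (split a₂ b₂ (△ a₂ b₂ c₀) (split a₂ b₀ (△ a₂ b₀ c₀) (□ a₀ b₀ a₂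
  b₂))) (split a₁ c₂ (split a₁ b₁ (△ a₁ b₁ c₂) (split b₀ c₂ (△ a₁ b₀ c₂) (split a₁ b₂ (split b₂ c₂
  (△ a₁ b₂ c₂) (□ a₀ b₀ c₂ b₂)) (□ a₀ b₁ a₁ b₂)))) (□ a₁ c₀ a₂ c₂)))) (split a₁ b₂ (split a₁ c₀ (△
  a₁ b₂ c₀) (split a₁ b₁ (split a₁ c₂ (△ a₁ b₁ c₂) (split a₁ c₁ (split b₁ c₁ (△ a₁ b₁ c₁) (split b₂
  c₁ (△ a₁ b₂ c₁) (□ a₀ b₁ c₁ b₂))) (□ a₁ c₁ a₂ c₂))) (□ a₀ b₀ a₁ b₁))) (□ a₀ b₀ a₁ b₂))) (□ a₀ b₀
  c₀ b₁))) (□ a₀ b₁ c₀ b₂)))) (split a₀ c₁ (split a₁ c₂ (split a₁ b₁ (△ a₁ b₁ c₂) (split a₁ b₀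
  (split b₀ c₂ (△ a₁ b₀ c₂) (split b₀ c₁ (split a₀ b₀ (△ a₀ b₀ c₁) (split a₁ c₁ (△ a₁ b₀ c₁) (split
  a₂ b₀ (split b₀ c₀ (split a₂ c₀ (△ a₂ b₀ c₀) (split a₁ c₀ (△ a₁ b₀ c₀) (□ a₁ c₀ a₂ c₁))) (split
  a₀ b₁ (split b₁ c₁ (△ a₀ b₁ c₁) (split a₂ c₀ (split a₀ c₀ (split a₁ c₀ (split b₂ c₀ (split a₁ b₂
  (△ a₁ b₂ c₀) (split a₂ b₂ (△ a₂ b₂ c₀) (□ a₁ b₂ a₂ c₁))) (split b₂ c₂ (split a₁ b₂ (△ a₁ b₂ c₂)
  (□ a₁ b₁ c₀ b₂)) (□ b₀ c₀ b₂ c₂))) (□ a₁ c₀ b₁ c₁)) (□ a₀ c₀ b₀ c₂)) (□ a₂ c₀ b₀ c₂))) (□ a₀ b₀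
  c₀ b₁))) (□ a₀ b₀ a₂ c₂)))) (□ a₂ c₁ b₀ c₂))) (split b₀ c₀ (split a₀ b₀ (split b₀ c₁ (△ a₀ b₀ c₁)
  (split a₀ c₀ (△ a₀ b₀ c₀) (split a₂ c₀ (split a₂ b₀ (△ a₂ b₀ c₀) (split b₁ c₁ (split a₀ b₁ (△ a₀
  b₁ c₁) (split a₁ c₀ (split a₁ c₁ (split b₀ c₂ (split a₁ b₂ (split b₂ c₁ (△ a₁ b₂ c₁) (split b₂ c₂
  (△ a₁ b₂ c₂) (□ a₂ c₁ b₂ c₂))) (split a₂ b₂ (split b₂ c₀ (△ a₂ b₂ c₀) (□ a₁ b₁ c₀ b₂)) (□ a₁ b₀
  a₂ b₂))) (□ a₂ c₁ b₀ c₂)) (□ a₁ b₀ a₂ c₁)) (□ a₀ b₁ a₁ c₀))) (□ a₁ b₀ c₁ b₁))) (□ a₀ c₀ a₂ c₂))))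
  (split a₂ b₀ (split a₂ c₀ (△ a₂ b₀ c₀) (split b₁ c₁ (split a₀ b₁ (△ a₀ b₁ c₁) (□ a₀ b₀ a₁ b₁)) (□
  a₂ c₀ b₁ c₁))) (□ a₀ b₀ a₂ c₂))) (□ a₁ b₀ c₀ b₁)))) (split a₁ c₁ (split b₂ c₁ (split a₁ b₂ (△ a₁
  b₂ c₁) (split a₀ b₂ (△ a₀ b₂ c₁) (□ a₀ b₂ a₁ c₂))) (split b₂ c₂ (split b₁ c₁ (split a₁ b₁ (△ a₁
  b₁ c₁) (split a₀ b₁ (△ a₀ b₁ c₁) (□ a₀ b₁ a₁ c₂))) (split b₂ c₀ (split a₂ c₀ (split a₂ b₂ (△ a₂
  b₂ c₀) (split a₁ b₂ (split a₁ c₀ (△ a₁ b₂ c₀) (split a₀ c₀ (split a₀ b₂ (△ a₀ b₂ c₀) (□ a₀ b₂ a₂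
  c₂)) (□ a₀ c₀ a₁ c₂))) (□ a₁ b₂ a₂ c₂))) (□ a₂ c₀ b₁ c₁)) (□ b₁ c₀ b₂ c₁))) (□ a₂ c₁ b₂ c₂))) (□
  a₁ c₁ a₂ c₂))) (□ a₀ c₁ a₂ c₂))))) (split b₁ c₁ (split a₂ c₁ (△ a₂ b₁ c₁) (split a₀ c₁ (split a₀
  b₁ (△ a₀ b₁ c₁) (split a₀ b₂ (split b₂ c₁ (△ a₀ b₂ c₁) (split b₂ c₂ (split a₀ c₂ (△ a₀ b₂ c₂)
  (split a₀ c₀ (split b₂ c₀ (△ a₀ b₂ c₀) (split a₂ c₀ (split b₀ c₀ (split a₀ b₀ (△ a₀ b₀ c₀) (split
  a₂ b₀ (△ a₂ b₀ c₀) (split a₂ c₂ (split a₂ b₂ (△ a₂ b₂ c₂) (split b₀ c₂ (split b₀ c₁ (split a₁ b₀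
  (split a₁ c₂ (△ a₁ b₀ c₂) (split a₁ c₀ (△ a₁ b₀ c₀) (□ a₁ c₀ b₁ c₂))) (split a₁ b₁ (split a₁ c₁
  (△ a₁ b₁ c₁) (□ a₁ b₀ a₂ c₁)) (□ a₀ b₀ a₁ b₁))) (□ a₂ b₀ c₁ b₂)) (□ a₀ b₀ c₂ b₁))) (□ a₀ b₀ a₂
  c₂)))) (split b₀ c₁ (split a₀ b₀ (△ a₀ b₀ c₁) (□ a₀ b₀ c₀ b₁)) (□ b₀ c₀ b₂ c₁))) (□ a₂ c₀ b₂
  c₁))) (□ a₀ c₀ b₁ c₂))) (split b₂ c₀ (split a₀ c₀ (△ a₀ b₂ c₀) (split a₂ c₂ (split a₀ c₂ (split
  b₀ c₂ (split a₀ b₀ (△ a₀ b₀ c₂) (split a₂ b₀ (△ a₂ b₀ c₂) (split a₂ c₀ (split a₂ b₂ (△ a₂ b₂ c₀)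
  (split b₀ c₁ (split b₀ c₀ (split a₁ b₀ (split a₁ c₀ (△ a₁ b₀ c₀) (split a₁ c₂ (△ a₁ b₀ c₂) (□ a₁
  c₀ b₁ c₂))) (split a₁ b₁ (split a₁ c₁ (△ a₁ b₁ c₁) (□ a₁ b₀ a₂ c₁)) (□ a₀ b₀ a₁ b₁))) (□ a₀ b₀ c₀
  b₁)) (□ a₂ b₀ c₁ b₂))) (□ a₀ b₀ a₂ c₀)))) (split b₀ c₁ (split a₀ b₀ (△ a₀ b₀ c₁) (□ a₀ b₀ c₂ b₁))
  (□ b₀ c₁ b₂ c₂))) (□ a₀ c₀ b₁ c₂)) (□ a₂ c₁ b₂ c₂))) (□ b₁ c₀ b₂ c₂)))) (split b₂ c₂ (split b₂ c₀
  (split a₁ b₂ (split a₁ c₂ (△ a₁ b₂ c₂) (split a₁ c₀ (△ a₁ b₂ c₀) (□ a₁ c₀ b₁ c₂))) (split a₁ b₁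
  (split a₁ c₁ (△ a₁ b₁ c₁) (split a₂ b₂ (split a₂ c₂ (△ a₂ b₂ c₂) (split a₂ c₀ (△ a₂ b₂ c₀) (□ a₂
  c₀ b₁ c₂))) (□ a₁ b₂ a₂ c₁))) (□ a₀ b₁ a₁ b₂))) (□ a₀ b₁ c₀ b₂)) (□ a₀ b₁ c₂ b₂)))) (split a₁ c₁
  (split a₁ b₁ (△ a₁ b₁ c₁) (split a₁ b₀ (split b₀ c₁ (△ a₁ b₀ c₁) (split b₀ c₂ (split a₁ c₂ (△ a₁
  b₀ c₂) (split a₁ c₀ (split b₀ c₀ (△ a₁ b₀ c₀) (split a₀ c₀ (split a₂ c₀ (split b₂ c₀ (split a₀ b₂
  (△ a₀ b₂ c₀) (split a₂ b₂ (△ a₂ b₂ c₀) (□ a₀ b₂ a₂ c₁))) (split a₁ b₂ (split b₂ c₁ (△ a₁ b₂ c₁)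
  (□ b₀ c₀ b₂ c₁)) (□ a₁ b₁ c₀ b₂))) (□ a₂ c₀ b₀ c₁)) (□ a₀ c₀ b₀ c₁))) (□ a₁ c₀ b₁ c₂))) (split b₀
  c₀ (split a₁ c₀ (△ a₁ b₀ c₀) (split a₀ c₂ (split a₂ c₂ (split a₁ c₂ (split b₂ c₂ (split a₀ b₂ (△
  a₀ b₂ c₂) (split a₂ b₂ (△ a₂ b₂ c₂) (□ a₀ b₂ a₂ c₁))) (split a₁ b₂ (split b₂ c₁ (△ a₁ b₂ c₁) (□
  b₀ c₁ b₂ c₂)) (□ a₁ b₁ c₂ b₂))) (□ a₁ c₀ b₁ c₂)) (□ a₂ c₁ b₀ c₂)) (□ a₀ c₁ b₀ c₂))) (□ b₀ c₀ b₁
  c₂)))) (split b₀ c₂ (split b₀ c₀ (split a₀ b₀ (split a₀ c₀ (△ a₀ b₀ c₀) (split a₀ c₂ (△ a₀ b₀ c₂)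
  (□ a₀ c₀ b₁ c₂))) (split a₂ b₀ (split a₂ c₂ (△ a₂ b₀ c₂) (split a₂ c₀ (△ a₂ b₀ c₀) (□ a₂ c₀ b₁
  c₂))) (□ a₀ b₀ a₂ c₁))) (□ a₁ b₀ c₀ b₁)) (□ a₁ b₀ c₂ b₁)))) (split b₀ c₂ (split a₀ c₂ (split a₀
  b₀ (△ a₀ b₀ c₂) (split a₁ b₀ (split a₁ c₂ (△ a₁ b₀ c₂) (split a₁ c₀ (split b₀ c₀ (△ a₁ b₀ c₀)
  (split a₂ c₂ (split a₂ b₀ (△ a₂ b₀ c₂) (□ a₀ b₀ a₂ c₁)) (□ a₁ c₁ a₂ c₂))) (□ a₁ c₀ b₁ c₂))) (□ a₀
  b₀ a₁ c₁))) (split a₁ c₂ (split a₁ b₀ (△ a₁ b₀ c₂) (split a₂ c₂ (split a₂ b₀ (△ a₂ b₀ c₂) (□ a₁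
  b₀ a₂ c₁)) (□ a₀ c₁ a₂ c₂))) (□ a₀ c₁ a₁ c₂))) (split b₀ c₀ (split a₀ c₀ (split a₀ b₀ (△ a₀ b₀
  c₀) (split a₁ b₀ (split a₁ c₀ (△ a₁ b₀ c₀) (split a₂ c₀ (split a₂ b₀ (△ a₂ b₀ c₀) (□ a₀ b₀ a₂
  c₁)) (□ a₁ c₀ a₂ c₁))) (□ a₀ b₀ a₁ c₁))) (split a₁ c₀ (split a₁ b₀ (△ a₁ b₀ c₀) (split a₂ c₀
  (split a₂ b₀ (△ a₂ b₀ c₀) (□ a₁ b₀ a₂ c₁)) (□ a₀ c₀ a₂ c₁))) (□ a₀ c₀ a₁ c₁))) (□ b₀ c₀ b₁
  c₂)))))) (split b₀ c₂ (split a₀ c₂ (split a₀ b₀ (△ a₀ b₀ c₂) (split b₂ c₂ (split a₀ b₂ (△ a₀ b₂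
  c₂) (split a₁ b₀ (split a₁ c₂ (△ a₁ b₀ c₂) (split a₁ c₀ (split b₀ c₀ (△ a₁ b₀ c₀) (split b₂ c₀
  (split b₀ c₁ (split a₁ c₁ (△ a₁ b₀ c₁) (□ a₁ c₁ b₁ c₂)) (□ b₀ c₀ b₁ c₁)) (□ a₀ b₀ c₀ b₂))) (□ a₁
  c₀ b₁ c₂))) (split a₁ b₂ (split a₁ c₂ (△ a₁ b₂ c₂) (split a₁ c₀ (split b₂ c₀ (△ a₁ b₂ c₀) (split
  b₂ c₁ (split a₁ c₁ (△ a₁ b₂ c₁) (□ a₁ c₁ b₁ c₂)) (□ b₁ c₀ b₂ c₁))) (□ a₁ c₀ b₁ c₂))) (□ a₀ b₀ a₁
  b₂)))) (split b₂ c₁ (split b₂ c₀ (split a₀ b₂ (split a₀ c₀ (△ a₀ b₂ c₀) (split a₀ c₁ (△ a₀ b₂ c₁)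
  (□ a₀ c₀ b₁ c₁))) (split a₀ b₁ (split a₁ b₂ (split a₁ c₀ (△ a₁ b₂ c₀) (split a₁ c₁ (△ a₁ b₂ c₁)
  (□ a₁ c₀ b₁ c₁))) (split a₁ b₀ (split a₁ c₂ (△ a₁ b₀ c₂) (split a₁ c₀ (split b₀ c₀ (△ a₁ b₀ c₀)
  (split a₁ c₁ (split b₀ c₁ (△ a₁ b₀ c₁) (□ b₀ c₀ b₁ c₁)) (□ a₁ c₁ b₁ c₂))) (□ a₁ c₀ b₁ c₂))) (□ a₀
  b₀ a₁ b₂))) (□ a₀ b₁ c₂ b₂))) (□ b₁ c₀ b₂ c₂)) (□ b₁ c₁ b₂ c₂)))) (split a₀ c₀ (split a₀ c₁
  (split b₂ c₁ (split a₀ b₂ (△ a₀ b₂ c₁) (split a₁ c₂ (split a₁ b₀ (△ a₁ b₀ c₂) (split a₁ b₂ (split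
  b₂ c₂ (△ a₁ b₂ c₂) (split a₁ c₁ (△ a₁ b₂ c₁) (split b₂ c₀ (split a₁ c₀ (△ a₁ b₂ c₀) (□ a₁ c₀ b₁
  c₁)) (□ b₁ c₀ b₂ c₂)))) (split a₀ b₀ (split b₀ c₀ (△ a₀ b₀ c₀) (split b₀ c₁ (△ a₀ b₀ c₁) (□ b₀ c₀
  b₁ c₁))) (□ a₀ b₀ a₁ b₂)))) (split a₁ b₂ (split a₁ c₁ (△ a₁ b₂ c₁) (□ a₁ c₁ b₁ c₂)) (□ a₀ b₂ a₁
  c₂)))) (split b₂ c₀ (split a₀ b₂ (△ a₀ b₂ c₀) (split b₂ c₂ (split a₀ b₁ (split a₁ c₂ (split a₁ b₂
  (△ a₁ b₂ c₂) (split a₁ b₀ (△ a₁ b₀ c₂) (split a₀ b₀ (split b₀ c₁ (△ a₀ b₀ c₁) (□ a₁ b₀ c₁ b₂)) (□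
  a₀ b₀ a₁ b₂)))) (split a₁ c₀ (split a₁ b₂ (△ a₁ b₂ c₀) (□ a₀ b₂ a₁ c₂)) (□ a₁ c₀ b₁ c₂))) (□ a₀
  b₁ c₁ b₂)) (□ b₁ c₁ b₂ c₂))) (□ b₁ c₀ b₂ c₁))) (□ a₀ c₁ b₁ c₂)) (□ a₀ c₀ b₁ c₂))) (split b₀ c₁
  (split b₀ c₀ (split a₁ b₀ (split a₁ c₀ (△ a₁ b₀ c₀) (split a₁ c₁ (△ a₁ b₀ c₁) (□ a₁ c₀ b₁ c₁)))
  (split a₁ b₁ (split a₀ b₀ (split a₀ c₀ (△ a₀ b₀ c₀) (split a₀ c₁ (△ a₀ b₀ c₁) (□ a₀ c₀ b₁ c₁)))
  (split a₀ b₁ (split a₂ b₀ (split a₂ c₁ (△ a₂ b₀ c₁) (split a₂ c₀ (△ a₂ b₀ c₀) (□ a₂ c₀ b₁ c₁)))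
  (split b₂ c₂ (split a₀ c₂ (split a₀ b₂ (△ a₀ b₂ c₂) (split a₂ b₂ (split a₂ c₂ (△ a₂ b₂ c₂) (split
  a₂ c₁ (split a₁ b₂ (split a₁ c₂ (△ a₁ b₂ c₂) (□ a₁ b₀ a₂ c₂)) (□ a₀ b₀ a₁ b₂)) (□ a₂ c₁ b₁ c₂)))
  (□ a₀ b₀ a₂ b₂))) (split a₁ c₂ (split a₁ b₂ (△ a₁ b₂ c₂) (split a₂ b₂ (split a₂ c₂ (△ a₂ b₂ c₂)
  (□ a₀ b₀ a₂ c₂)) (□ a₁ b₀ a₂ b₂))) (□ a₀ b₀ a₁ c₂))) (split b₂ c₁ (split a₂ b₂ (split a₂ c₁ (△ a₂
  b₂ c₁) (split a₂ c₀ (split b₂ c₀ (△ a₂ b₂ c₀) (□ b₁ c₀ b₂ c₂)) (□ a₂ c₀ b₁ c₁))) (□ a₂ b₀ c₂ b₂))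
  (□ b₁ c₁ b₂ c₂)))) (□ a₀ b₀ c₂ b₁))) (□ a₁ b₀ c₂ b₁))) (□ b₀ c₀ b₁ c₂)) (□ b₀ c₁ b₁ c₂))))))
  (split a₁ b₁ (split b₁ c₀ (split a₁ c₀ (△ a₁ b₁ c₀) (split a₀ c₀ (split a₀ b₁ (△ a₀ b₁ c₀) (split
  a₀ b₂ (split b₂ c₀ (△ a₀ b₂ c₀) (split b₂ c₂ (split a₀ c₂ (△ a₀ b₂ c₂) (split a₂ c₂ (split a₂ b₂
  (△ a₂ b₂ c₂) (split a₂ b₀ (split b₀ c₂ (△ a₂ b₀ c₂) (split b₀ c₁ (split a₂ c₁ (△ a₂ b₀ c₁) (split
  a₀ c₁ (split b₂ c₁ (△ a₀ b₂ c₁) (split a₁ c₁ (split b₁ c₁ (△ a₁ b₁ c₁) (□ a₂ b₁ c₁ b₂)) (□ a₁ c₀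
  b₂ c₁))) (□ a₀ b₁ a₂ c₁))) (split a₀ c₁ (split b₂ c₁ (△ a₀ b₂ c₁) (split b₀ c₀ (split a₀ b₀ (△ a₀
  b₀ c₀) (split a₂ c₀ (△ a₂ b₀ c₀) (split b₁ c₁ (split a₁ c₁ (△ a₁ b₁ c₁) (□ a₁ c₀ b₂ c₁)) (□ a₀ b₀
  c₁ b₁)))) (□ b₀ c₀ b₂ c₁))) (□ a₀ c₁ b₀ c₂)))) (split a₀ b₀ (split b₀ c₀ (△ a₀ b₀ c₀) (□ a₂ b₀ c₀
  b₂)) (□ a₀ b₀ a₂ b₁)))) (□ a₀ b₁ a₂ c₂))) (split a₁ c₂ (split b₁ c₂ (△ a₁ b₁ c₂) (split a₂ b₂
  (split b₂ c₁ (split a₂ c₁ (△ a₂ b₂ c₁) (split a₀ c₁ (△ a₀ b₂ c₁) (□ a₀ b₁ a₂ c₁))) (split a₁ c₁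
  (split b₁ c₁ (△ a₁ b₁ c₁) (□ b₁ c₁ b₂ c₂)) (□ a₁ c₀ b₂ c₁))) (□ a₂ b₁ c₂ b₂))) (□ a₁ c₀ b₂ c₂))))
  (split a₂ b₂ (split a₀ b₀ (split b₀ c₀ (△ a₀ b₀ c₀) (split b₀ c₂ (split a₀ c₂ (△ a₀ b₀ c₂) (split
  a₂ c₂ (split b₂ c₂ (△ a₂ b₂ c₂) (split b₁ c₂ (split a₁ c₂ (△ a₁ b₁ c₂) (split b₂ c₀ (split a₂ c₀
  (△ a₂ b₂ c₀) (split a₂ b₀ (△ a₂ b₀ c₂) (split a₁ b₀ (split a₁ b₂ (split a₁ c₁ (split b₂ c₁ (△ a₁
  b₂ c₁) (split b₁ c₁ (△ a₁ b₁ c₁) (□ a₀ b₁ c₁ b₂))) (split b₂ c₁ (split a₂ c₁ (△ a₂ b₂ c₁) (□ a₁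
  c₀ a₂ c₁)) (□ a₁ c₁ b₂ c₂))) (□ a₀ b₂ a₁ c₂)) (□ a₁ b₀ a₂ c₀)))) (□ a₁ c₀ b₂ c₂))) (□ a₀ b₁ c₂
  b₂))) (□ a₀ b₁ a₂ c₂))) (split a₁ c₂ (split b₁ c₂ (△ a₁ b₁ c₂) (split b₂ c₂ (split a₂ c₂ (△ a₂ b₂
  c₂) (split a₂ c₀ (split b₂ c₀ (△ a₂ b₂ c₀) (split a₁ b₂ (△ a₁ b₂ c₂) (split a₁ b₀ (split a₂ b₀
  (split a₀ c₂ (split b₀ c₁ (split a₂ c₁ (△ a₂ b₀ c₁) (split a₀ c₁ (△ a₀ b₀ c₁) (□ a₀ b₁ a₂ c₁)))
  (split b₁ c₁ (split a₁ c₁ (△ a₁ b₁ c₁) (□ a₁ c₀ b₀ c₁)) (□ b₀ c₁ b₁ c₂))) (□ a₀ b₁ a₂ c₂)) (□ a₂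
  b₀ c₂ b₁)) (□ a₁ b₀ c₀ b₂)))) (□ a₂ c₀ b₀ c₂))) (□ a₀ b₁ c₂ b₂))) (□ a₁ c₀ b₀ c₂)))) (split a₂ b₀
  (split a₂ c₂ (split b₀ c₂ (△ a₂ b₀ c₂) (split b₂ c₂ (△ a₂ b₂ c₂) (□ a₀ b₀ c₂ b₂))) (split a₀ c₂
  (split a₂ c₁ (split b₂ c₁ (△ a₂ b₂ c₁) (split b₀ c₁ (△ a₂ b₀ c₁) (□ a₀ b₀ c₁ b₂))) (split a₀ c₁
  (split a₂ c₀ (split b₂ c₀ (△ a₂ b₂ c₀) (split b₀ c₀ (△ a₂ b₀ c₀) (□ a₀ b₀ c₀ b₂))) (split a₁ c₂
  (split b₁ c₂ (△ a₁ b₁ c₂) (split b₀ c₂ (split a₁ c₁ (split b₁ c₁ (△ a₁ b₁ c₁) (□ a₂ c₁ b₁ c₂)) (□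
  a₁ c₀ a₂ c₁)) (□ a₀ b₀ c₂ b₁))) (□ a₁ c₀ a₂ c₂))) (□ a₀ b₁ a₂ c₁))) (□ a₀ b₁ a₂ c₂))) (□ a₀ b₀ a₂
  b₁))) (□ a₀ b₁ a₂ b₂)))) (split a₁ c₂ (split b₁ c₂ (△ a₁ b₁ c₂) (split b₀ c₂ (split a₁ b₀ (△ a₁
  b₀ c₂) (split a₀ b₀ (split a₀ c₂ (△ a₀ b₀ c₂) (split a₀ c₁ (split b₀ c₁ (△ a₀ b₀ c₁) (split b₂ c₁
  (split a₀ b₂ (△ a₀ b₂ c₁) (split a₁ b₂ (split b₂ c₂ (△ a₁ b₂ c₂) (split a₁ c₁ (△ a₁ b₂ c₁) (split
  a₂ b₂ (split a₂ c₁ (△ a₂ b₂ c₁) (split a₂ c₀ (split b₂ c₀ (△ a₂ b₂ c₀) (□ a₀ c₀ b₂ c₂)) (□ a₁ c₀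
  a₂ c₁))) (□ a₂ b₁ c₂ b₂)))) (□ a₀ b₂ a₁ c₀))) (split a₁ b₂ (split b₂ c₂ (△ a₁ b₂ c₂) (split b₁ c₁
  (split a₀ b₁ (△ a₀ b₁ c₁) (split a₁ c₁ (△ a₁ b₁ c₁) (split a₂ c₂ (split a₂ b₀ (△ a₂ b₀ c₂) (split
  a₂ c₀ (split a₂ b₂ (split b₂ c₀ (△ a₂ b₂ c₀) (□ a₀ c₀ b₂ c₂)) (□ a₂ b₀ c₁ b₂)) (□ a₀ b₁ a₂ c₀)))
  (□ a₀ b₁ a₂ c₂)))) (□ b₁ c₁ b₂ c₂))) (□ a₁ b₀ c₁ b₂)))) (split a₁ c₁ (split b₁ c₁ (△ a₁ b₁ c₁) (□
  a₀ c₁ b₁ c₂)) (□ a₀ c₀ a₁ c₁)))) (□ a₀ b₀ a₁ c₀))) (split a₂ b₀ (split b₂ c₂ (split a₁ b₂ (△ a₁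
  b₂ c₂) (split a₀ b₂ (split a₀ c₂ (△ a₀ b₂ c₂) (split b₀ c₀ (split a₂ c₀ (△ a₂ b₀ c₀) (split a₂ c₂
  (split a₂ b₂ (△ a₂ b₂ c₂) (□ a₁ b₂ a₂ c₀)) (□ a₀ c₀ a₂ c₂))) (□ a₀ c₀ b₀ c₂))) (□ a₀ b₂ a₁ c₀)))
  (split a₂ b₂ (split b₂ c₁ (split a₂ c₁ (△ a₂ b₂ c₁) (split a₂ c₀ (split b₀ c₀ (△ a₂ b₀ c₀) (split
  b₂ c₀ (△ a₂ b₂ c₀) (□ b₀ c₀ b₂ c₂))) (split a₁ c₁ (split b₁ c₁ (△ a₁ b₁ c₁) (split a₁ b₂ (△ a₁ b₂
  c₁) (split a₀ c₁ (split a₀ b₂ (△ a₀ b₂ c₁) (□ a₀ b₂ a₁ c₀)) (□ a₀ c₀ a₂ c₁)))) (□ a₁ c₀ a₂ c₁))))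
  (split b₀ c₁ (split a₂ c₁ (△ a₂ b₀ c₁) (split b₁ c₁ (split a₁ c₁ (△ a₁ b₁ c₁) (split a₀ c₁ (split
  a₀ b₁ (△ a₀ b₁ c₁) (split a₀ b₀ (△ a₀ b₀ c₁) (□ a₀ b₀ c₂ b₁))) (□ a₀ c₀ a₁ c₁))) (□ b₁ c₁ b₂
  c₂))) (□ b₀ c₁ b₂ c₂))) (□ a₂ b₁ c₂ b₂))) (□ a₂ b₀ c₂ b₁)))) (split a₀ c₂ (split a₁ c₁ (split b₁
  c₁ (△ a₁ b₁ c₁) (split b₂ c₁ (split a₁ b₂ (△ a₁ b₂ c₁) (split a₀ b₂ (split b₂ c₂ (△ a₀ b₂ c₂)
  (split a₀ c₁ (△ a₀ b₂ c₁) (split b₂ c₀ (split a₂ b₂ (split a₂ c₀ (△ a₂ b₂ c₀) (split a₂ c₁ (△ a₂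
  b₂ c₁) (□ a₀ c₀ a₂ c₁))) (split b₁ c₂ (split a₀ b₁ (△ a₀ b₁ c₂) (split a₂ c₀ (split a₂ c₂ (split
  a₂ c₁ (split a₂ b₀ (split b₀ c₂ (△ a₂ b₀ c₂) (split b₀ c₀ (△ a₂ b₀ c₀) (□ a₁ c₀ b₀ c₂))) (split
  b₀ c₂ (split a₀ b₀ (△ a₀ b₀ c₂) (□ a₀ b₀ a₂ b₁)) (□ a₂ b₀ c₂ b₂))) (□ a₀ b₁ a₂ c₁)) (□ a₁ b₂ a₂
  c₂)) (□ a₀ b₁ a₂ c₀))) (□ a₂ b₁ c₂ b₂))) (□ a₁ c₀ b₂ c₂)))) (□ a₀ b₂ a₁ c₀))) (split a₂ b₂ (split
  b₂ c₂ (split a₀ b₂ (△ a₀ b₂ c₂) (split a₂ c₂ (△ a₂ b₂ c₂) (split a₂ c₀ (split b₂ c₀ (△ a₂ b₂ c₀)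
  (split a₀ b₁ (split b₁ c₂ (△ a₀ b₁ c₂) (split a₀ c₁ (split a₂ c₁ (split a₁ b₂ (split b₀ c₁ (split
  a₂ b₀ (△ a₂ b₀ c₁) (split a₁ b₀ (△ a₁ b₀ c₁) (□ a₁ b₀ a₂ c₂))) (split b₀ c₂ (split a₀ b₀ (△ a₀ b₀
  c₂) (□ a₀ b₀ c₁ b₂)) (□ b₀ c₁ b₁ c₂))) (□ a₀ b₂ a₁ c₀)) (□ a₂ c₁ b₁ c₂)) (□ a₀ c₀ b₂ c₁))) (□ a₀
  b₁ c₁ b₂))) (□ a₁ c₀ a₂ c₂)))) (split b₂ c₀ (split a₂ c₀ (△ a₂ b₂ c₀) (split a₀ b₁ (split b₁ c₂
  (△ a₀ b₁ c₂) (□ b₁ c₁ b₂ c₂)) (□ a₀ b₁ a₂ c₀))) (□ a₁ c₀ b₂ c₂))) (□ a₂ b₁ c₁ b₂)))) (split a₀ c₁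
  (split a₀ b₂ (split b₂ c₂ (△ a₀ b₂ c₂) (split b₂ c₁ (△ a₀ b₂ c₁) (□ a₁ c₁ b₂ c₂))) (split a₁ b₂
  (split a₀ b₁ (split b₁ c₂ (△ a₀ b₁ c₂) (split b₁ c₁ (△ a₀ b₁ c₁) (□ a₁ c₁ b₁ c₂))) (split a₂ b₂
  (split a₂ c₀ (split b₂ c₀ (△ a₂ b₂ c₀) (split b₂ c₂ (split a₂ c₂ (△ a₂ b₂ c₂) (split a₂ c₁ (split
  b₂ c₁ (△ a₂ b₂ c₁) (□ a₁ c₀ b₂ c₁)) (□ a₁ c₁ a₂ c₂))) (□ a₁ c₀ b₂ c₂))) (□ a₀ b₁ a₂ c₀)) (□ a₀ b₁
  a₂ b₂))) (□ a₀ b₂ a₁ c₀))) (□ a₀ c₀ a₁ c₁))) (□ a₀ c₀ a₁ c₂))))) (split b₁ c₂ (split a₁ c₂ (△ a₁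
  b₁ c₂) (split a₀ c₂ (split a₀ b₁ (△ a₀ b₁ c₂) (split a₀ b₂ (split b₂ c₂ (△ a₀ b₂ c₂) (split b₂ c₀
  (split a₀ c₀ (△ a₀ b₂ c₀) (split a₂ c₀ (split a₂ b₂ (△ a₂ b₂ c₀) (split a₂ b₀ (split b₀ c₀ (△ a₂
  b₀ c₀) (split a₀ b₀ (split b₀ c₂ (△ a₀ b₀ c₂) (split a₁ c₀ (split a₁ b₂ (△ a₁ b₂ c₀) (split a₁ b₀
  (split a₂ c₂ (split b₀ c₁ (split a₀ c₁ (△ a₀ b₀ c₁) (split a₂ c₁ (△ a₂ b₀ c₁) (□ a₀ b₁ a₂ c₁)))
  (split b₁ c₁ (split a₁ c₁ (△ a₁ b₁ c₁) (□ a₁ c₁ b₀ c₂)) (□ b₀ c₀ b₁ c₁))) (□ a₁ b₂ a₂ c₂)) (□ a₁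
  b₀ c₂ b₂))) (□ a₁ c₀ b₀ c₂))) (□ a₀ b₀ c₀ b₁))) (split a₀ b₀ (split b₀ c₂ (△ a₀ b₀ c₂) (□ a₂ b₀
  c₂ b₂)) (□ a₀ b₀ a₂ b₁)))) (□ a₀ b₁ a₂ c₀))) (split a₁ c₀ (split a₂ b₂ (split b₂ c₁ (split a₂ c₁
  (△ a₂ b₂ c₁) (split a₀ c₁ (△ a₀ b₂ c₁) (□ a₀ b₁ a₂ c₁))) (split a₁ c₁ (split b₁ c₁ (△ a₁ b₁ c₁)
  (□ b₁ c₀ b₂ c₁)) (□ a₁ c₁ b₂ c₂))) (□ a₂ b₁ c₀ b₂)) (□ a₁ c₀ b₂ c₂)))) (split a₂ b₂ (split b₂ c₀
  (split a₂ c₀ (△ a₂ b₂ c₀) (split a₀ c₀ (split a₀ b₀ (split b₀ c₀ (△ a₀ b₀ c₀) (split b₀ c₂ (△ a₀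
  b₀ c₂) (split a₁ c₀ (split a₂ c₂ (split b₂ c₂ (△ a₂ b₂ c₂) (split a₁ b₂ (△ a₁ b₂ c₀) (split a₁ b₀
  (split a₂ b₀ (split b₀ c₁ (split a₂ c₁ (△ a₂ b₀ c₁) (split a₀ c₁ (△ a₀ b₀ c₁) (□ a₀ b₁ a₂ c₁)))
  (split b₁ c₁ (split a₁ c₁ (△ a₁ b₁ c₁) (□ a₁ c₁ b₀ c₂)) (□ b₀ c₀ b₁ c₁))) (□ a₂ b₀ c₀ b₁)) (□ a₁
  b₀ c₂ b₂)))) (□ a₂ c₀ b₀ c₂)) (□ a₁ c₀ b₀ c₂)))) (split a₂ b₀ (split b₀ c₀ (split a₂ c₁ (split b₂
  c₁ (△ a₂ b₂ c₁) (split b₀ c₁ (△ a₂ b₀ c₁) (□ a₀ b₀ c₁ b₂))) (split b₁ c₁ (split a₁ c₁ (△ a₁ b₁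
  c₁) (split a₂ c₂ (split b₀ c₂ (△ a₂ b₀ c₂) (split b₂ c₂ (△ a₂ b₂ c₂) (□ a₀ b₀ c₂ b₂))) (□ a₁ c₁
  a₂ c₂))) (□ a₂ c₀ b₁ c₁))) (□ a₀ b₀ c₀ b₁)) (□ a₀ b₀ a₂ b₁))) (□ a₀ b₁ a₂ c₀))) (□ a₀ b₁ c₀ b₂))
  (□ a₀ b₁ a₂ b₂)))) (split a₁ c₁ (split b₁ c₁ (△ a₁ b₁ c₁) (split b₂ c₁ (split a₁ b₂ (△ a₁ b₂ c₁)
  (split a₀ b₂ (split a₀ c₁ (△ a₀ b₂ c₁) (split a₀ c₀ (split b₂ c₀ (△ a₀ b₂ c₀) (split a₂ b₂ (split
  a₂ c₁ (△ a₂ b₂ c₁) (split a₂ c₂ (split b₂ c₂ (△ a₂ b₂ c₂) (split a₁ c₀ (split a₂ c₀ (split a₀ b₁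
  (split b₀ c₀ (split a₁ b₀ (△ a₁ b₀ c₀) (split a₀ b₀ (△ a₀ b₀ c₀) (□ a₀ b₀ a₁ c₂))) (split b₀ c₂
  (split a₂ b₀ (△ a₂ b₀ c₂) (□ a₂ b₀ c₀ b₁)) (□ b₀ c₀ b₂ c₂))) (□ a₀ b₁ a₂ c₁)) (□ a₂ c₀ b₁ c₁)) (□
  a₁ c₀ b₂ c₂))) (□ a₀ c₁ a₂ c₂))) (□ a₂ b₁ c₀ b₂))) (□ a₀ c₀ b₁ c₁))) (□ a₀ b₂ a₁ c₂))) (split b₂
  c₀ (split a₂ b₂ (split a₂ c₀ (△ a₂ b₂ c₀) (split a₂ c₁ (split b₀ c₁ (split a₂ b₀ (△ a₂ b₀ c₁)
  (split a₁ b₀ (△ a₁ b₀ c₁) (split a₀ b₀ (split a₀ c₁ (△ a₀ b₀ c₁) (split a₀ c₀ (split b₀ c₀ (△ a₀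
  b₀ c₀) (□ a₂ b₀ c₀ b₁)) (□ a₀ c₀ b₁ c₁))) (□ a₀ b₀ a₁ c₂)))) (split b₀ c₀ (split a₂ b₀ (split a₀
  c₀ (split a₀ b₂ (△ a₀ b₂ c₀) (split a₀ b₀ (△ a₀ b₀ c₀) (□ a₀ b₀ c₁ b₂))) (split a₂ c₂ (split b₀
  c₂ (△ a₂ b₀ c₂) (split b₂ c₂ (△ a₂ b₂ c₂) (□ b₀ c₁ b₂ c₂))) (□ a₀ c₀ a₂ c₂))) (□ a₂ b₀ c₁ b₁)) (□
  b₀ c₀ b₁ c₁))) (□ a₂ c₀ b₁ c₁))) (□ a₂ b₁ c₁ b₂)) (□ b₁ c₀ b₂ c₁)))) (split a₀ c₁ (split b₂ c₁
  (split a₀ b₂ (△ a₀ b₂ c₁) (split a₁ b₂ (split a₂ b₂ (split a₂ c₁ (△ a₂ b₂ c₁) (split a₂ c₂ (split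
  b₂ c₂ (△ a₂ b₂ c₂) (split b₂ c₀ (split a₁ c₀ (△ a₁ b₂ c₀) (split a₂ c₀ (△ a₂ b₂ c₀) (□ a₁ c₀ a₂
  c₁))) (split a₀ b₁ (split b₁ c₁ (△ a₀ b₁ c₁) (split a₁ c₀ (split a₀ c₀ (split a₂ c₀ (split b₀ c₀
  (split a₂ b₀ (△ a₂ b₀ c₀) (split a₁ b₀ (△ a₁ b₀ c₀) (□ a₁ b₀ a₂ c₁))) (split b₀ c₂ (split a₂ b₀
  (△ a₂ b₀ c₂) (□ a₂ b₀ c₀ b₁)) (□ b₀ c₀ b₂ c₂))) (□ a₂ c₀ b₁ c₁)) (□ a₀ c₀ b₂ c₂)) (□ a₁ c₀ b₁
  c₁))) (□ a₀ b₁ c₀ b₂)))) (□ a₁ c₁ a₂ c₂))) (split a₀ b₁ (split b₁ c₁ (△ a₀ b₁ c₁) (split a₁ c₀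
  (split b₂ c₀ (△ a₁ b₂ c₀) (□ a₂ b₁ c₀ b₂)) (□ a₁ c₀ b₁ c₁))) (□ a₀ b₁ a₂ b₂))) (□ a₀ b₂ a₁ c₂)))
  (split b₂ c₂ (split a₂ b₂ (split a₂ c₂ (△ a₂ b₂ c₂) (split a₀ b₁ (split b₁ c₁ (△ a₀ b₁ c₁) (split
  b₂ c₀ (split a₂ c₀ (△ a₂ b₂ c₀) (split a₁ c₀ (split a₁ b₂ (△ a₁ b₂ c₀) (split a₀ c₀ (split a₀ b₂
  (△ a₀ b₂ c₀) (□ a₀ b₂ a₁ c₂)) (□ a₀ c₀ a₂ c₂))) (□ a₁ c₀ a₂ c₂))) (□ b₁ c₀ b₂ c₁))) (□ a₀ b₁ a₂
  c₂))) (split b₁ c₁ (split a₀ b₁ (△ a₀ b₁ c₁) (split b₂ c₀ (split a₀ b₂ (split a₀ c₀ (△ a₀ b₂ c₀)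
  (split a₁ c₀ (split a₁ b₂ (△ a₁ b₂ c₀) (split a₂ c₂ (split a₂ c₁ (split a₂ c₀ (split a₂ b₀ (split
  b₀ c₁ (△ a₂ b₀ c₁) (split b₀ c₂ (△ a₂ b₀ c₂) (□ a₁ c₁ b₀ c₂))) (split a₁ b₀ (split b₀ c₀ (△ a₁ b₀
  c₀) (□ a₂ b₀ c₀ b₁)) (□ a₁ b₀ a₂ b₂))) (□ a₀ b₁ a₂ c₀)) (□ a₁ b₂ a₂ c₁)) (□ a₀ b₁ a₂ c₂))) (□ a₀
  c₀ a₁ c₂))) (□ a₀ b₁ a₂ b₂)) (□ a₂ b₁ c₀ b₂))) (□ a₂ b₁ c₁ b₂))) (□ a₁ c₁ b₂ c₂))) (□ a₀ c₁ a₁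
  c₂))))) (split b₁ c₁ (split a₁ c₁ (△ a₁ b₁ c₁) (split a₀ c₁ (split a₀ b₁ (△ a₀ b₁ c₁) (split a₀
  b₂ (split b₂ c₁ (△ a₀ b₂ c₁) (split b₂ c₂ (split a₀ c₂ (△ a₀ b₂ c₂) (split a₂ c₂ (split a₂ b₂ (△
  a₂ b₂ c₂) (split b₂ c₀ (split a₀ c₀ (△ a₀ b₂ c₀) (□ a₀ c₀ b₁ c₂)) (□ a₂ b₁ c₀ b₂))) (□ a₀ b₁ a₂
  c₂))) (split b₂ c₀ (split a₀ c₀ (△ a₀ b₂ c₀) (split a₂ c₀ (split a₂ b₂ (△ a₂ b₂ c₀) (□ a₂ b₁ c₂
  b₂)) (□ a₀ b₁ a₂ c₀))) (□ b₁ c₀ b₂ c₂)))) (split a₂ b₂ (split b₂ c₂ (split a₂ c₂ (△ a₂ b₂ c₂)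
  (split a₂ c₀ (split b₂ c₀ (△ a₂ b₂ c₀) (□ a₀ b₁ c₀ b₂)) (□ a₂ c₀ b₁ c₂))) (□ a₀ b₁ c₂ b₂)) (□ a₀
  b₁ a₂ b₂)))) (split b₀ c₂ (split a₀ c₂ (split a₀ b₀ (△ a₀ b₀ c₂) (split a₁ b₀ (split a₁ c₂ (△ a₁
  b₀ c₂) (split a₁ c₀ (split b₀ c₀ (△ a₁ b₀ c₀) (split a₂ b₀ (split a₂ c₂ (△ a₂ b₀ c₂) (split a₂ c₁
  (split b₀ c₁ (△ a₂ b₀ c₁) (split a₀ c₀ (split a₂ c₀ (split a₀ b₁ (split b₂ c₀ (split a₂ b₂ (△ a₂
  b₂ c₀) (split a₁ b₂ (△ a₁ b₂ c₀) (□ a₁ b₂ a₂ c₂))) (split b₂ c₂ (split a₀ b₂ (△ a₀ b₂ c₂) (□ a₀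
  b₀ c₀ b₂)) (□ b₁ c₀ b₂ c₂))) (□ a₀ b₀ c₀ b₁)) (□ a₂ c₀ b₁ c₂)) (□ a₀ c₀ b₀ c₁))) (□ a₁ c₁ a₂
  c₂))) (□ a₂ b₀ c₀ b₁))) (□ a₁ c₀ b₁ c₂))) (□ a₀ b₀ a₁ c₁))) (split a₁ c₂ (split a₁ b₀ (△ a₁ b₀
  c₂) (split a₀ c₀ (split a₀ b₀ (split b₀ c₀ (△ a₀ b₀ c₀) (split a₂ b₀ (split a₂ c₂ (△ a₂ b₀ c₂)
  (split a₂ c₁ (split b₀ c₁ (△ a₂ b₀ c₁) (split a₁ c₀ (split a₂ c₀ (split a₀ b₁ (split b₂ c₀ (split
  a₂ b₂ (△ a₂ b₂ c₀) (split a₀ b₂ (△ a₀ b₂ c₀) (□ a₀ b₂ a₂ c₂))) (split b₂ c₂ (split a₁ b₂ (△ a₁ b₂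
  c₂) (□ a₁ b₀ c₀ b₂)) (□ b₁ c₀ b₂ c₂))) (□ a₀ b₁ a₂ c₂)) (□ a₂ c₀ b₁ c₂)) (□ a₁ c₀ b₀ c₁))) (□ a₀
  c₁ a₂ c₂))) (□ a₂ b₀ c₀ b₁))) (□ a₀ b₀ a₁ c₁)) (□ a₀ c₀ b₁ c₂))) (□ a₀ c₁ a₁ c₂))) (split b₀ c₀
  (split a₂ b₀ (split a₂ c₀ (△ a₂ b₀ c₀) (split a₂ c₂ (split a₀ c₀ (split a₀ b₀ (△ a₀ b₀ c₀) (split
  a₁ b₀ (split a₁ c₀ (△ a₁ b₀ c₀) (split a₂ c₁ (split b₀ c₁ (△ a₂ b₀ c₁) (split a₁ c₂ (split a₀ c₂
  (split a₀ b₁ (split b₂ c₂ (split a₂ b₂ (△ a₂ b₂ c₂) (split a₁ b₂ (△ a₁ b₂ c₂) (□ a₁ b₂ a₂ c₀)))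
  (split a₂ b₂ (split b₂ c₁ (△ a₂ b₂ c₁) (□ b₀ c₁ b₂ c₂)) (□ a₂ b₁ c₂ b₂))) (□ a₀ b₀ c₂ b₁)) (□ a₀
  c₁ b₀ c₂)) (□ a₁ c₀ b₁ c₂))) (□ a₁ c₀ a₂ c₁))) (□ a₀ b₀ a₁ c₁))) (split a₁ c₀ (split a₁ b₀ (△ a₁
  b₀ c₀) (split a₂ c₁ (split b₀ c₁ (△ a₂ b₀ c₁) (split a₀ c₂ (split a₁ c₂ (split a₀ b₁ (split a₀ b₀
  (split b₂ c₂ (split a₂ b₂ (△ a₂ b₂ c₂) (split a₀ b₂ (△ a₀ b₂ c₂) (□ a₀ b₂ a₂ c₀))) (split a₂ b₂
  (split b₂ c₁ (△ a₂ b₂ c₁) (□ b₀ c₁ b₂ c₂)) (□ a₂ b₁ c₂ b₂))) (□ a₀ b₀ a₁ c₁)) (□ a₀ b₁ a₂ c₀)) (□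
  a₁ c₁ b₀ c₂)) (□ a₀ c₀ b₁ c₂))) (□ a₀ c₀ a₂ c₁))) (□ a₀ c₀ a₁ c₁))) (□ a₂ c₀ b₁ c₂))) (□ a₂ b₀ c₂
  b₁)) (□ b₀ c₀ b₁ c₂))))) (split b₀ c₂ (split a₂ b₀ (split a₂ c₂ (△ a₂ b₀ c₂) (split a₂ c₁ (split
  b₀ c₁ (△ a₂ b₀ c₁) (split b₀ c₀ (split a₂ c₀ (△ a₂ b₀ c₀) (□ a₂ c₀ b₁ c₂)) (□ b₀ c₀ b₁ c₁))) (□
  a₂ c₁ b₁ c₂))) (split b₀ c₁ (split b₀ c₀ (split a₀ b₀ (split a₀ c₀ (△ a₀ b₀ c₀) (split a₀ c₂ (△
  a₀ b₀ c₂) (□ a₀ c₀ b₁ c₂))) (split a₀ b₁ (split a₁ b₀ (split a₁ c₂ (△ a₁ b₀ c₂) (split a₁ c₀ (△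
  a₁ b₀ c₀) (□ a₁ c₀ b₁ c₂))) (split a₂ b₂ (split a₂ c₂ (split b₂ c₂ (△ a₂ b₂ c₂) (split b₂ c₁
  (split a₂ c₁ (△ a₂ b₂ c₁) (split a₀ c₁ (split b₂ c₀ (split a₂ c₀ (△ a₂ b₂ c₀) (□ a₂ c₀ b₁ c₁)) (□
  b₁ c₀ b₂ c₂)) (□ a₀ b₀ a₂ c₁))) (□ b₁ c₁ b₂ c₂))) (split a₂ c₁ (split b₂ c₁ (△ a₂ b₂ c₁) (split
  b₂ c₀ (split a₂ c₀ (△ a₂ b₂ c₀) (□ a₂ c₀ b₁ c₂)) (□ b₁ c₀ b₂ c₁))) (□ a₂ c₁ b₁ c₂))) (split a₁ b₂
  (split b₂ c₂ (split a₁ c₂ (△ a₁ b₂ c₂) (split a₀ c₂ (split a₀ b₂ (△ a₀ b₂ c₂) (□ a₀ b₀ a₂ b₂)) (□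
  a₀ b₀ a₁ c₂))) (□ a₂ b₁ c₂ b₂)) (□ a₁ b₀ a₂ b₂)))) (□ a₀ b₀ a₂ b₁))) (□ a₂ b₀ c₀ b₁)) (□ a₂ b₀ c₁
  b₁))) (split b₀ c₁ (split a₂ b₀ (split a₂ c₁ (△ a₂ b₀ c₁) (split a₂ c₀ (split b₀ c₀ (△ a₂ b₀ c₀)
  (□ b₀ c₀ b₁ c₂)) (□ a₂ c₀ b₁ c₁))) (□ a₂ b₀ c₂ b₁)) (□ b₀ c₁ b₁ c₂)))))) (split a₀ b₁ (split b₁
  c₀ (split a₀ c₀ (△ a₀ b₁ c₀) (split a₀ c₂ (split b₁ c₂ (△ a₀ b₁ c₂) (split b₀ c₂ (split a₀ b₀ (△
  a₀ b₀ c₂) (split a₁ b₀ (split a₁ c₂ (△ a₁ b₀ c₂) (split a₂ c₂ (split a₂ b₀ (△ a₂ b₀ c₂) (split a₂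
  c₀ (split a₂ b₂ (split b₂ c₂ (△ a₂ b₂ c₂) (split b₂ c₀ (△ a₂ b₂ c₀) (split a₁ c₀ (split b₀ c₀ (△
  a₁ b₀ c₀) (split a₁ b₂ (split a₀ b₂ (split b₂ c₁ (split a₀ c₁ (△ a₀ b₂ c₁) (split a₂ c₁ (△ a₂ b₂
  c₁) (□ a₀ b₀ a₂ c₁))) (split b₁ c₁ (split a₀ c₁ (△ a₀ b₁ c₁) (□ a₀ c₀ b₂ c₁)) (□ b₁ c₁ b₂ c₂)))
  (□ a₀ b₀ c₀ b₂)) (□ a₁ b₁ c₂ b₂))) (□ a₁ c₀ b₂ c₂)))) (split a₀ b₂ (split b₂ c₂ (△ a₀ b₂ c₂) (□
  a₂ b₁ c₂ b₂)) (□ a₀ b₀ a₂ b₂))) (□ a₀ b₀ a₂ c₀))) (□ a₁ b₁ a₂ c₂))) (split a₂ b₀ (split a₂ c₂ (△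
  a₂ b₀ c₂) (split a₁ c₀ (split a₁ c₂ (split a₁ b₂ (split b₂ c₂ (△ a₁ b₂ c₂) (split b₂ c₀ (△ a₁ b₂
  c₀) (split a₂ c₀ (split b₀ c₀ (△ a₂ b₀ c₀) (split a₂ b₂ (split a₀ b₂ (split b₂ c₁ (split a₀ c₁ (△
  a₀ b₂ c₁) (split a₁ c₁ (△ a₁ b₂ c₁) (□ a₀ b₀ a₁ c₁))) (split b₁ c₁ (split a₀ c₁ (△ a₀ b₁ c₁) (□
  a₀ c₀ b₂ c₁)) (□ b₁ c₁ b₂ c₂))) (□ a₀ b₀ c₀ b₂)) (□ a₂ b₁ c₂ b₂))) (□ a₂ c₀ b₂ c₂)))) (split a₀
  b₂ (split b₂ c₂ (△ a₀ b₂ c₂) (□ a₁ b₁ c₂ b₂)) (□ a₀ b₀ a₁ b₂))) (□ a₁ b₁ a₂ c₂)) (□ a₀ b₀ a₁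
  c₀))) (□ a₁ b₀ a₂ b₁)))) (split a₁ b₀ (split a₂ b₀ (split b₀ c₁ (split a₂ c₁ (△ a₂ b₀ c₁) (split
  a₁ c₁ (△ a₁ b₀ c₁) (□ a₁ b₁ a₂ c₁))) (split b₁ c₁ (split a₀ c₁ (△ a₀ b₁ c₁) (split b₀ c₀ (split
  a₁ c₀ (△ a₁ b₀ c₀) (split a₂ c₀ (△ a₂ b₀ c₀) (□ a₁ b₁ a₂ c₀))) (□ a₀ c₀ b₀ c₁))) (□ b₀ c₁ b₁
  c₂))) (□ a₂ b₀ c₂ b₁)) (□ a₁ b₀ c₂ b₁)))) (split a₀ c₁ (split b₁ c₁ (△ a₀ b₁ c₁) (split b₂ c₁
  (split a₀ b₂ (△ a₀ b₂ c₁) (split a₂ b₂ (split a₂ c₁ (△ a₂ b₂ c₁) (split a₁ c₁ (split a₁ b₂ (△ a₁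
  b₂ c₁) (split a₁ c₂ (split a₁ c₀ (split a₁ b₀ (split b₀ c₂ (△ a₁ b₀ c₂) (split b₀ c₀ (△ a₁ b₀ c₀)
  (□ a₀ c₀ b₀ c₂))) (split b₀ c₁ (split a₀ b₀ (△ a₀ b₀ c₁) (□ a₀ b₀ a₁ b₂)) (□ a₁ b₀ c₁ b₁))) (□ a₀
  b₂ a₁ c₀)) (□ a₀ b₂ a₁ c₂))) (□ a₁ b₁ a₂ c₁))) (split a₁ b₂ (split a₁ c₁ (△ a₁ b₂ c₁) (split a₂
  c₂ (split a₂ c₀ (split a₂ c₁ (split a₂ b₀ (split b₀ c₂ (△ a₂ b₀ c₂) (split b₀ c₀ (△ a₂ b₀ c₀) (□
  a₀ c₀ b₀ c₂))) (split b₀ c₁ (split a₀ b₀ (△ a₀ b₀ c₁) (□ a₀ b₀ a₂ b₂)) (□ a₂ b₀ c₁ b₁))) (□ a₁ b₁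
  a₂ c₁)) (□ a₀ b₂ a₂ c₀)) (□ a₀ b₂ a₂ c₂))) (□ a₁ b₁ a₂ b₂)))) (split a₂ b₂ (split a₁ b₂ (split b₂
  c₂ (split a₁ c₂ (△ a₁ b₂ c₂) (split a₂ c₂ (△ a₂ b₂ c₂) (□ a₁ b₁ a₂ c₂))) (split b₂ c₀ (split a₁
  c₀ (△ a₁ b₂ c₀) (split a₂ c₀ (△ a₂ b₂ c₀) (□ a₁ b₁ a₂ c₀))) (□ a₀ c₀ b₂ c₂))) (□ a₁ b₁ c₁ b₂)) (□
  a₂ b₁ c₁ b₂)))) (split a₁ b₀ (split a₁ c₂ (split b₀ c₂ (△ a₁ b₀ c₂) (split b₀ c₁ (split a₁ c₁ (△
  a₁ b₀ c₁) (split a₂ c₁ (split a₂ b₀ (△ a₂ b₀ c₁) (split a₁ c₀ (split b₀ c₀ (△ a₁ b₀ c₀) (□ a₀ c₀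
  b₀ c₂)) (□ a₀ c₀ a₁ c₁))) (□ a₁ b₁ a₂ c₁))) (□ a₀ c₁ b₀ c₂))) (split a₁ c₁ (split b₀ c₁ (△ a₁ b₀
  c₁) (split a₁ c₀ (split b₀ c₀ (△ a₁ b₀ c₀) (□ a₀ c₀ b₀ c₁)) (□ a₀ c₀ a₁ c₂))) (□ a₀ c₁ a₁ c₂)))
  (split a₂ b₀ (split a₂ c₂ (split b₀ c₂ (△ a₂ b₀ c₂) (split b₀ c₁ (split a₂ c₁ (△ a₂ b₀ c₁) (split
  a₂ c₀ (split b₀ c₀ (△ a₂ b₀ c₀) (□ a₀ c₀ b₀ c₂)) (□ a₀ c₀ a₂ c₁))) (□ a₀ c₁ b₀ c₂))) (split a₂ c₁
  (split b₀ c₁ (△ a₂ b₀ c₁) (split a₂ c₀ (split b₀ c₀ (△ a₂ b₀ c₀) (□ a₀ c₀ b₀ c₁)) (□ a₀ c₀ a₂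
  c₂))) (□ a₀ c₁ a₂ c₂))) (□ a₁ b₀ a₂ b₁)))))) (split b₁ c₂ (split a₀ c₂ (△ a₀ b₁ c₂) (split a₀ c₁
  (split b₁ c₁ (△ a₀ b₁ c₁) (split b₂ c₁ (split a₀ b₂ (△ a₀ b₂ c₁) (split a₂ b₂ (split a₂ c₁ (△ a₂
  b₂ c₁) (split a₂ c₀ (split b₂ c₀ (△ a₂ b₂ c₀) (split a₁ b₂ (split a₁ c₁ (△ a₁ b₂ c₁) (□ a₁ b₁ a₂
  c₁)) (□ a₁ b₁ c₀ b₂))) (□ a₂ c₀ b₁ c₁))) (split a₁ b₂ (split a₁ c₁ (△ a₁ b₂ c₁) (split a₁ c₀
  (split b₂ c₀ (△ a₁ b₂ c₀) (□ a₂ b₁ c₀ b₂)) (□ a₁ c₀ b₁ c₁))) (□ a₁ b₁ a₂ b₂)))) (split b₂ c₀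
  (split a₂ b₂ (split a₂ c₀ (△ a₂ b₂ c₀) (split a₁ c₀ (split a₁ b₂ (△ a₁ b₂ c₀) (□ a₁ b₁ c₁ b₂)) (□
  a₁ b₁ a₂ c₀))) (□ a₂ b₁ c₁ b₂)) (□ b₁ c₀ b₂ c₁)))) (split a₁ b₀ (split a₁ c₁ (split b₀ c₁ (△ a₁
  b₀ c₁) (split b₀ c₂ (split a₁ c₂ (△ a₁ b₀ c₂) (split a₂ c₂ (split a₂ b₀ (△ a₂ b₀ c₂) (split b₀ c₀
  (split a₁ c₀ (△ a₁ b₀ c₀) (split a₀ c₀ (split a₀ b₀ (△ a₀ b₀ c₀) (split a₂ c₁ (split a₂ c₀ (split
  b₁ c₁ (split a₂ b₂ (split b₂ c₁ (△ a₂ b₂ c₁) (split b₂ c₂ (△ a₂ b₂ c₂) (□ a₀ c₁ b₂ c₂))) (split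
  b₂ c₁ (split a₁ b₂ (△ a₁ b₂ c₁) (□ a₁ b₁ a₂ b₂)) (□ a₂ b₀ c₁ b₂))) (□ a₂ b₀ c₁ b₁)) (□ a₁ b₁ a₂
  c₀)) (□ a₀ b₀ a₂ c₁))) (□ a₀ c₀ a₁ c₂))) (□ a₂ b₀ c₀ b₁))) (□ a₁ b₁ a₂ c₂))) (□ a₀ c₁ b₀ c₂)))
  (split a₁ c₂ (split b₀ c₂ (△ a₁ b₀ c₂) (split a₂ c₁ (split b₀ c₁ (split a₂ b₀ (△ a₂ b₀ c₁) (split
  b₀ c₀ (split a₁ c₀ (△ a₁ b₀ c₀) (split a₀ c₀ (split a₀ b₀ (△ a₀ b₀ c₀) (split a₂ c₂ (split a₂ c₀
  (split b₁ c₁ (split a₂ b₂ (split b₂ c₂ (△ a₂ b₂ c₂) (split b₂ c₁ (△ a₂ b₂ c₁) (□ a₀ c₁ b₂ c₂)))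
  (split b₂ c₂ (split a₁ b₂ (△ a₁ b₂ c₂) (□ a₁ b₁ a₂ b₂)) (□ a₂ b₀ c₂ b₂))) (□ a₁ c₀ b₁ c₁)) (□ a₁
  b₁ a₂ c₀)) (□ a₀ b₀ a₂ c₂))) (□ a₀ c₀ a₁ c₁))) (□ a₂ b₀ c₀ b₁))) (□ a₀ c₁ b₀ c₂)) (□ a₁ b₁ a₂
  c₁))) (□ a₀ c₁ a₁ c₂))) (split a₂ b₀ (split b₀ c₀ (split a₂ c₀ (△ a₂ b₀ c₀) (split a₁ c₀ (split
  a₂ c₁ (split b₀ c₁ (△ a₂ b₀ c₁) (split b₀ c₂ (split a₂ c₂ (△ a₂ b₀ c₂) (split a₀ c₀ (split a₀ b₀
  (△ a₀ b₀ c₀) (split a₁ c₂ (split a₁ c₁ (split b₁ c₁ (split a₁ b₂ (split b₂ c₁ (△ a₁ b₂ c₁) (split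
  b₂ c₂ (△ a₁ b₂ c₂) (□ a₀ c₁ b₂ c₂))) (split a₂ b₂ (split b₂ c₁ (△ a₂ b₂ c₁) (□ a₁ b₀ c₁ b₂)) (□
  a₁ b₁ a₂ b₂))) (□ a₁ b₀ c₁ b₁)) (□ a₀ b₀ a₁ c₁)) (□ a₀ b₀ a₁ c₂))) (□ a₀ c₀ a₂ c₂))) (□ a₀ c₁ b₀
  c₂))) (split a₂ c₂ (split b₀ c₂ (△ a₂ b₀ c₂) (split a₀ c₀ (split a₀ b₀ (△ a₀ b₀ c₀) (split a₁ c₁
  (split a₁ c₂ (split b₁ c₁ (split b₀ c₁ (split a₁ b₂ (split b₂ c₂ (△ a₁ b₂ c₂) (split b₂ c₁ (△ a₁
  b₂ c₁) (□ a₀ c₁ b₂ c₂))) (split b₂ c₂ (split a₂ b₂ (△ a₂ b₂ c₂) (□ a₁ b₁ a₂ b₂)) (□ a₁ b₀ c₂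
  b₂))) (□ a₀ c₁ b₀ c₂)) (□ a₂ c₀ b₁ c₁)) (□ a₀ b₀ a₁ c₂)) (□ a₀ b₀ a₁ c₁))) (□ a₀ c₀ a₂ c₁))) (□
  a₀ c₁ a₂ c₂))) (□ a₁ b₁ a₂ c₀))) (□ a₁ b₀ c₀ b₁)) (□ a₁ b₀ a₂ b₁))))) (split b₁ c₁ (split a₀ c₁
  (△ a₀ b₁ c₁) (split b₀ c₂ (split a₁ b₀ (split a₁ c₂ (△ a₁ b₀ c₂) (split a₂ c₂ (split a₂ b₀ (△ a₂
  b₀ c₂) (split a₁ c₀ (split b₀ c₀ (△ a₁ b₀ c₀) (□ a₂ b₀ c₀ b₁)) (□ a₁ c₀ b₁ c₂))) (□ a₁ b₁ a₂
  c₂))) (split a₂ b₀ (split a₂ c₂ (△ a₂ b₀ c₂) (split a₂ c₀ (split b₀ c₀ (△ a₂ b₀ c₀) (□ a₁ b₀ c₀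
  b₁)) (□ a₂ c₀ b₁ c₂))) (□ a₁ b₀ a₂ b₁))) (split b₀ c₀ (split a₁ b₀ (split a₁ c₀ (△ a₁ b₀ c₀)
  (split a₂ c₀ (split a₂ b₀ (△ a₂ b₀ c₀) (□ a₂ b₀ c₂ b₁)) (□ a₁ b₁ a₂ c₀))) (□ a₁ b₀ c₂ b₁)) (□ b₀
  c₀ b₁ c₂)))) (split b₀ c₂ (split a₁ b₀ (split a₁ c₂ (△ a₁ b₀ c₂) (split a₂ c₂ (split a₂ b₀ (△ a₂
  b₀ c₂) (split a₁ c₀ (split b₀ c₀ (△ a₁ b₀ c₀) (□ a₂ b₀ c₀ b₁)) (□ a₁ c₀ b₁ c₂))) (□ a₁ b₁ a₂
  c₂))) (split a₂ b₀ (split a₂ c₂ (△ a₂ b₀ c₂) (split a₂ c₁ (split b₀ c₁ (△ a₂ b₀ c₁) (□ a₁ b₀ c₁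
  b₁)) (□ a₂ c₁ b₁ c₂))) (□ a₁ b₀ a₂ b₁))) (split b₀ c₁ (split a₁ b₀ (split a₁ c₁ (△ a₁ b₀ c₁)
  (split a₁ c₀ (split b₀ c₀ (△ a₁ b₀ c₀) (□ b₀ c₀ b₁ c₂)) (□ a₁ c₀ b₁ c₁))) (□ a₁ b₀ c₂ b₁)) (□ b₀
  c₁ b₁ c₂)))))) (split a₁ b₀ (split a₁ c₂ (split b₀ c₂ (△ a₁ b₀ c₂) (split a₁ b₂ (split b₂ c₂ (△
  a₁ b₂ c₂) (split b₂ c₁ (split a₁ c₁ (△ a₁ b₂ c₁) (split a₀ c₁ (split a₀ b₂ (△ a₀ b₂ c₁) (split a₀
  b₀ (split a₂ b₂ (split a₂ c₁ (△ a₂ b₂ c₁) (□ a₁ b₁ a₂ c₁)) (□ a₀ b₁ a₂ b₂)) (□ a₀ b₀ c₂ b₂))) (□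
  a₀ b₁ a₁ c₁))) (split b₀ c₁ (split a₁ c₁ (△ a₁ b₀ c₁) (split a₀ c₁ (split a₀ b₀ (△ a₀ b₀ c₁)
  (split a₂ b₀ (split a₂ c₁ (△ a₂ b₀ c₁) (□ a₁ b₁ a₂ c₁)) (□ a₀ b₀ a₂ b₁))) (□ a₀ b₁ a₁ c₁))) (□ b₀
  c₁ b₂ c₂)))) (split a₂ b₂ (split a₀ b₂ (split b₂ c₂ (split a₀ c₂ (△ a₀ b₂ c₂) (split a₂ c₂ (△ a₂
  b₂ c₂) (□ a₀ b₁ a₂ c₂))) (split b₁ c₂ (split b₂ c₁ (split a₀ c₁ (△ a₀ b₂ c₁) (split a₂ c₁ (△ a₂
  b₂ c₁) (□ a₀ b₁ a₂ c₁))) (split b₀ c₁ (split a₁ c₁ (△ a₁ b₀ c₁) (split a₀ c₁ (split a₀ b₀ (△ a₀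
  b₀ c₁) (split a₂ b₀ (split a₂ c₁ (△ a₂ b₀ c₁) (□ a₁ b₁ a₂ c₁)) (□ a₀ b₀ a₂ b₁))) (□ a₀ b₁ a₁
  c₁))) (□ b₀ c₁ b₂ c₂))) (□ a₁ b₁ c₂ b₂))) (□ a₀ b₁ a₁ b₂)) (□ a₁ b₁ a₂ b₂)))) (split a₀ c₂ (split
  a₂ c₂ (split a₂ b₂ (split b₂ c₂ (△ a₂ b₂ c₂) (split a₁ c₀ (split b₀ c₀ (△ a₁ b₀ c₀) (split b₂ c₀
  (split a₁ b₂ (△ a₁ b₂ c₀) (split a₂ c₀ (△ a₂ b₂ c₀) (split a₀ b₂ (split a₀ c₀ (△ a₀ b₂ c₀) (□ a₀
  b₁ a₂ c₀)) (□ a₀ b₁ a₁ b₂)))) (split b₀ c₂ (split a₀ b₀ (△ a₀ b₀ c₂) (split a₂ b₀ (△ a₂ b₀ c₂) (□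
  a₀ b₀ a₂ b₁))) (□ b₀ c₀ b₂ c₂)))) (split b₂ c₀ (split a₂ c₀ (△ a₂ b₂ c₀) (□ a₁ b₁ a₂ c₀)) (□ a₁
  c₀ b₂ c₂)))) (split a₀ b₂ (split b₂ c₂ (△ a₀ b₂ c₂) (split a₁ b₂ (split b₁ c₂ (split a₁ c₀ (split
  b₂ c₀ (△ a₁ b₂ c₀) (split b₀ c₀ (△ a₁ b₀ c₀) (split b₀ c₂ (split a₂ b₀ (△ a₂ b₀ c₂) (□ a₂ b₀ c₀
  b₂)) (□ b₀ c₀ b₂ c₂)))) (split a₀ c₀ (split b₂ c₀ (△ a₀ b₂ c₀) (□ a₁ c₀ b₂ c₂)) (□ a₀ b₁ a₁ c₀)))
  (□ a₂ b₁ c₂ b₂)) (□ a₁ b₁ a₂ b₂))) (□ a₀ b₁ a₂ b₂))) (□ a₁ b₁ a₂ c₂)) (□ a₀ b₁ a₁ c₂))) (split a₂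
  b₀ (split a₀ b₀ (split b₀ c₂ (split a₀ c₂ (△ a₀ b₀ c₂) (split a₂ c₂ (△ a₂ b₀ c₂) (□ a₀ b₁ a₂
  c₂))) (split b₁ c₂ (split b₀ c₁ (split a₀ c₁ (△ a₀ b₀ c₁) (split a₂ c₁ (△ a₂ b₀ c₁) (□ a₀ b₁ a₂
  c₁))) (split b₁ c₁ (split b₀ c₀ (split a₀ c₀ (△ a₀ b₀ c₀) (split a₂ c₀ (△ a₂ b₀ c₀) (□ a₀ b₁ a₂
  c₀))) (split b₁ c₀ (split a₁ b₂ (split a₁ c₂ (split b₂ c₂ (△ a₁ b₂ c₂) (split b₂ c₁ (split a₁ c₁
  (△ a₁ b₂ c₁) (split a₀ c₁ (split b₂ c₀ (split a₁ c₀ (△ a₁ b₂ c₀) (□ a₁ c₀ b₀ c₁)) (□ b₀ c₀ b₂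
  c₂)) (□ a₀ b₁ a₁ c₁))) (□ b₀ c₁ b₂ c₂))) (split a₁ c₀ (split b₂ c₀ (△ a₁ b₂ c₀) (split b₂ c₁
  (split a₁ c₁ (△ a₁ b₂ c₁) (□ a₁ c₁ b₀ c₂)) (□ b₀ c₀ b₂ c₁))) (□ a₁ c₀ b₀ c₂))) (split a₂ b₂
  (split b₂ c₂ (split a₂ c₂ (△ a₂ b₂ c₂) (split a₀ c₂ (split a₀ b₂ (△ a₀ b₂ c₂) (□ a₀ b₁ a₁ b₂)) (□
  a₀ b₁ a₂ c₂))) (□ a₁ b₀ c₂ b₂)) (□ a₁ b₁ a₂ b₂))) (□ a₁ b₀ c₀ b₁))) (□ a₁ b₀ c₁ b₁))) (□ a₁ b₀ c₂
  b₁))) (□ a₀ b₀ a₁ b₁)) (□ a₁ b₀ a₂ b₁)))))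

-- Opaque, so that elaboration never unfolds the certificate.
opaque
  K₃ₓ₃-arrows : Arrows 3 3 3 (C3C4nK2 1)
  K₃ₓ₃-arrows c = closes-sound c certificate [] (toWitness {a? = closes? certificate []} tt) []

-- Upper bound

upper-step : ∀ n → Arrows 3 (2 + n) 3 (C3C4nK2 n) → Arrows 3 (3 + n) 3 (C3C4nK2 (suc n))
upper-step n ih c with K₃ₓ₃-arrows (restrict c (prefix n))
... | red   , C₃ = red  , copy-restrict c (prefix-injective n) C₃
... | blue  , C₄ = blue , copy-restrict c (prefix-injective n) C₄
... | green , K₂
  with u , v , uv ← matching-has-edge {G = ColourClass c green} (copy-restrict c (prefix-injective n) K₂)
  with ih (restrict c (omitting u v))
... | red   , C₃ = red  , copy-restrict c (omitting-injective u v) C₃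
... | blue  , C₄ = blue , copy-restrict c (omitting-injective u v) C₄
... | green , M  = green , matching-extend (colourClass-sym c green) uv (proj₁ uv ∘ cong proj₁)
                             (copy-restrict c (omitting-injective u v) M)
                             (omitting-avoids u v (proj₁ uv) ∘ proj₁ M)

arrows-upper : ∀ n → Arrows 3 (2 + n) 3 (C3C4nK2 n)
arrows-upper zero    c = green , matching-empty {G = ColourClass c green}
arrows-upper (suc n)   = upper-step n (arrows-upper n)

-- Lower bound

-- Part zero is A; spoke i q colours the edges from aᵢ to part suc q.
spoke : ∀ {s} → Fin s → Fin 2 → Fin 3
spoke zero          zero       = blue
spoke zero          (suc zero) = red
spoke (suc zero)    zero       = red
spoke (suc zero)    (suc zero) = blue
spoke (suc (suc _)) _          = green

critical : ∀ s → Colouring 3 3 s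
critical s = record { col = criticalCol ; symm = criticalCol-sym }
  where
  criticalCol : KV 3 s → KV 3 s → Fin 3
  criticalCol (zero , _)  (zero , _)  = red
  criticalCol (zero , i)  (suc q , _) = spoke i q
  criticalCol (suc p , _) (zero , i)  = spoke i p
  criticalCol (suc _ , _) (suc _ , _) = red

  criticalCol-sym : ∀ u v → criticalCol u v ≡ criticalCol v u
  criticalCol-sym (zero , _)  (zero , _)  = refl
  criticalCol-sym (zero , _)  (suc _ , _) = refl
  criticalCol-sym (suc _ , _) (zero , _)  = refl
  criticalCol-sym (suc _ , _) (suc _ , _) = refl

side : ∀ {s} → KV 3 s → Fin 2
side (zero , zero)        = zero
side (zero , suc zero)    = suc zero
side (zero , suc (suc _)) = zero
side (suc q , _)          = q

spoke-red : ∀ {s} (i : Fin s) q → spoke i q ≡ red → side (zero , i) ≢ q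
spoke-red zero          (suc zero) _ ()
spoke-red (suc zero)    zero       _ ()
spoke-red zero          zero       ()
spoke-red (suc zero)    (suc zero) ()
spoke-red (suc (suc _)) _          ()

spoke-blue : ∀ {s} (i : Fin s) q → spoke i q ≡ blue → toℕ i ≡ toℕ q
spoke-blue zero          zero       _ = refl
spoke-blue (suc zero)    (suc zero) _ = refl
spoke-blue zero          (suc zero) ()
spoke-blue (suc zero)    zero       ()
spoke-blue (suc (suc _)) _          ()

hub : ∀ {s} → Fin (s ∸ 2) → Fin s
hub {suc (suc s)} j = suc (suc j)

spoke-green : ∀ {s} (i : Fin s) q → spoke i q ≡ green → Σ (Fin (s ∸ 2)) λ j → i ≡ hub j
spoke-green (suc (suc j)) _          _ = j , refl
spoke-green zero          zero       ()
spoke-green zero          (suc zero) ()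
spoke-green (suc zero)    zero       ()
spoke-green (suc zero)    (suc zero) ()

module _ {s : ℕ} where

  red-crosses : ∀ x y → ColourClass (critical s) red x y → side x ≢ side y
  red-crosses (zero , _)  (zero , _)  (x≁y , _) = ⊥-elim (x≁y refl)
  red-crosses (zero , i)  (suc q , _) (_ , xy)  = spoke-red i q xy
  red-crosses (suc p , _) (zero , i)  (_ , xy)  = spoke-red i p xy ∘ sym
  red-crosses (suc p , _) (suc q , _) (x≁y , _) = x≁y ∘ cong suc

  blue-unique-neighbour : ∀ x y z → proj₁ y ≢ zero →
    ColourClass (critical s) blue x y → ColourClass (critical s) blue z y → x ≡ z
  blue-unique-neighbour _           (zero , _)  _           y∉A _        _        = ⊥-elim (y∉A refl)
  blue-unique-neighbour (zero , i)  (suc q , _) (zero , k)  _   (_ , xy) (_ , zy) =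
    cong (zero ,_) (toℕ-injective (trans (spoke-blue i q xy) (sym (spoke-blue k q zy))))
  blue-unique-neighbour (suc _ , _) (suc _ , _) _           _   (_ , ()) _
  blue-unique-neighbour (zero , _)  (suc _ , _) (suc _ , _) _   _        (_ , ())

  green-cover : ∀ x y → ColourClass (critical s) green x y →
                Σ (Fin (s ∸ 2)) λ j → x ≡ (zero , hub j) ⊎ y ≡ (zero , hub j)
  green-cover (zero , _)  (zero , _)  (x≁y , _) = ⊥-elim (x≁y refl)
  green-cover (zero , i)  (suc q , _) (_ , xy) with j , refl ← spoke-green i q xy = j , inj₁ refl
  green-cover (suc p , _) (zero , i)  (_ , xy) with j , refl ← spoke-green i p xy = j , inj₂ refl
  green-cover (suc _ , _) (suc _ , _) (_ , ())

critical-not-arrows : ∀ n s → 1 ≤ n → s < 2 + n → ¬ Arrows 3 s 3 (C3C4nK2 n)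
critical-not-arrows n s 1≤n s<2+n arrows with arrows (critical s)
... | red   , C₃ = bipartite-triangle-free side red-crosses C₃
... | blue  , C₄ = star-forest-C4-free (λ x → proj₁ x ≡ zero) (λ x → proj₁ x ≟ zero)
                     (λ x∈A y∈A (x≁y , _) → x≁y (trans x∈A (sym y∈A))) blue-unique-neighbour C₄
... | green , M  = cover-bounds-matching (λ j → zero , hub j) green-cover
                     (m<n+o⇒m∸n<o s 2 {{>-nonZero 1≤n}} s<2+n) M

-- Two parts

monochromatic : ∀ {j t} → Colouring 3 j t
monochromatic = record { col = λ _ _ → red ; symm = λ _ _ → refl }

bipartite-not-arrows : ∀ n t → 1 ≤ n → ¬ Arrows 2 t 3 (C3C4nK2 n)
bipartite-not-arrows zero    _ () _
bipartite-not-arrows (suc n) t _  arrows with arrows monochromatic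
... | red   , C₃                 = bipartite-triangle-free proj₁ (λ _ _ → proj₁) C₃
... | blue  , (_ , _ , f-edge) = case f-edge zero (suc zero) (inj₁ refl) of λ ()
... | green , (_ , _ , f-edge) = case f-edge (zero , zero) (zero , suc zero) (refl , λ ()) of λ ()

theorem3 : ∀ (n : ℕ) → 2 ≤ n →
    MultipartiteRamseyInfinite 2 3 (C3C4nK2 n) × MultipartiteRamseyIs 3 3 (C3C4nK2 n) (n + 2)
theorem3 n 2≤n rewrite +-comm n 2 =
  (λ t _ → bipartite-not-arrows n t 1≤n) ,
  s≤s z≤n , arrows-upper n , (λ s _ → critical-not-arrows n s 1≤n)
  where
  1≤n : 1 ≤ n
  1≤n = <⇒≤ 2≤n
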